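{- Let $G$ be a connected chordal graph. Then there is a spanning cactus subgraph of $G$ with the maximum number of edges (among all spanning cactus subgraphs of $G$) in which every cycle has length $3$.
   Context: All graphs are finite, simple and undirected. A graph is chordal if it has no induced cycle of length greater than $3$. A cactus is a connected graph in which every edge lies in at most one cycle. A spanning cactus subgraph of $G$ is a subgraph $(V(G),E')$ with $E'\subseteq E(G)$ that is a cactus. -}

module Defs where

open import Data.Nat using (ℕ; zero; suc; _+_; _≤_; _<ᵇ_)
open import Data.Nat.DivMod using (_mod_)
open import Data.Fin using (Fin; toℕ)
open import Data.Bool using (Bool; true; false; _∧_; if_then_else_)
open import Data.List using (List; map; allFin)
open import Data.Nat.ListAction using (sum)
open import Data.Empty using (⊥)
open import Data.Product using (Σ; ∃; _×_; _,_)
open import Data.Sum using (_⊎_)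
open import Function using (_⇔_)
open import Function.Definitions using (Injective)
open import Relation.Binary.PropositionalEquality using (_≡_)

record Graph (n : ℕ) : Set where
  field
    adj   : Fin n → Fin n → Bool
    sym   : ∀ u v → adj u v ≡ adj v u
    irrefl : ∀ u → adj u u ≡ false
open Graph public

Adj : ∀ {n} → Graph n → Fin n → Fin n → Set
Adj G u v = adj G u v ≡ true

numEdges : ∀ {n} → Graph n → ℕ
numEdges {n} G =
  sum (map (λ i → sum (map (λ j → if (toℕ i <ᵇ toℕ j) ∧ adj G i j then 1 else 0)
                             (allFin n)))
           (allFin n))

data Walk {n} (G : Graph n) : Fin n → Fin n → Set where
  here : ∀ {u} → Walk G u u
  step : ∀ {u v w} → Adj G u v → Walk G v w → Walk G u w

Connected : ∀ {n} → Graph n → Set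
Connected G = ∀ u v → Walk G u v

next : ∀ {k} → Fin (suc k) → Fin (suc k)
next {k} i = suc (toℕ i) mod suc k

record Cycle {n} (G : Graph n) (m : ℕ) : Set where
  field
    vert  : Fin (3 + m) → Fin n
    inj   : Injective _≡_ _≡_ vert
    edges : ∀ i → Adj G (vert i) (vert (next i))
open Cycle public

Induced : ∀ {n} {G : Graph n} {m} → Cycle G m → Set
Induced {G = G} C = ∀ i j → Adj G (vert C i) (vert C j) → (j ≡ next i) ⊎ (i ≡ next j)

Chordal : ∀ {n} → Graph n → Set
Chordal G = ∀ m → 1 ≤ m → (C : Cycle G m) → Induced C → ⊥

CycleEdge : ∀ {n} {G : Graph n} {m} → Cycle G m → Fin n → Fin n → Set
CycleEdge C a b = ∃ λ i → (vert C i ≡ a × vert C (next i) ≡ b)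
                        ⊎ (vert C i ≡ b × vert C (next i) ≡ a)

-- Cactus: connected, and every edge lies in at most one cycle
-- (two cycles through a common edge have the same edge set, i.e. are the same cycle).
Cactus : ∀ {n} → Graph n → Set
Cactus G = Connected G ×
  (∀ u v → Adj G u v → ∀ m₁ m₂ (C₁ : Cycle G m₁) (C₂ : Cycle G m₂) →
     CycleEdge C₁ u v → CycleEdge C₂ u v →
     ∀ a b → CycleEdge C₁ a b ⇔ CycleEdge C₂ a b)

Subgraph : ∀ {n} → Graph n → Graph n → Set
Subgraph H G = ∀ u v → Adj H u v → Adj G u v

SpanningCactus : ∀ {n} → Graph n → Graph n → Set
SpanningCactus H G = Subgraph H G × Cactus H

AllCyclesTriangles : ∀ {n} → Graph n → Set
AllCyclesTriangles H = ∀ m → Cycle H m → m ≡ 0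

-- Among the spanning subgraphs H of G in which no edge lies on two different cycles, take one
-- maximising the number of edges and, among those, the number of edges lying on a triangle
-- (there are finitely many candidates, and the cactus property is decidable). Such an H is
-- connected: an edge ab of G missing from H either closes a cycle through a path of H from a to b,
-- or could be added to H. If H had a cycle of length at least 4, chordality of G gives three
-- consecutive vertices c0 c1 c2 of the cycle with c0c2 an edge of G; trading the cycle edge c2c3
-- for c0c2 keeps the number of edges and the cactus property while making c0c1 and c1c2 triangle
-- edges, contradicting the choice of H.

module Submission where

open import Defs hiding (sym)

open import Data.Bool using (Bool; true; false; _∧_; if_then_else_)
import Data.Bool.Properties as BP
open import Data.Empty using (⊥; ⊥-elim)
open import Data.Fin using (Fin; zero; suc; toℕ; fromℕ; inject₁; _≟_)
open import Data.Fin.Properties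
  using (0≢1+n; suc-injective; toℕ-injective; toℕ-fromℕ<; toℕ-inject₁; toℕ-fromℕ; toℕ<n; all?; any?; injective⇒≤; ¬∀⟶∃¬)
open import Data.List using (List; []; _∷_; _++_; [_]; length; tabulate; lookup; map; allFin)
open import Data.List.Properties
  using (length-++-comm; ∷ʳ-injective; ∷-injective; ++-assoc; ++-identityʳ; tabulate-lookup; length-tabulate)
open import Data.Nat using (ℕ; zero; suc; _+_; _*_; _≤_; _<_; z≤n; s≤s; s≤s⁻¹; _≤?_; _<ᵇ_)
open import Data.Nat.DivMod using (_%_; m<n⇒m%n≡m; n%n≡0)
open import Data.Nat.ListAction using (sum)
open import Data.Nat.Properties
  using (≤-refl; ≤-trans; ≤-antisym; ≤-total; ≤-reflexive; <-cmp; <-≤-trans; <⇒≤; <⇒≱; ≰⇒>; ≮⇒≥; n≤1+n; m≤m+n;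
         <ᵇ⇒<; <⇒<ᵇ; +-comm; +-suc; +-mono-≤; +-monoʳ-<; +-mono-≤-<; *-identityʳ; *-monoˡ-≤; module ≤-Reasoning)
open import Data.Product using (Σ; ∃; ∃₂; _×_; _,_; proj₁; proj₂)
open import Data.Product.Properties using (≡-dec)
open import Data.Sum using (_⊎_; inj₁; inj₂; swap)
import Data.Sum as Sum
open import Data.Unit using (⊤; tt)
open import Function using (_∘_; id; mk⇔; Equivalence)
open import Relation.Binary.Definitions using (DecidableEquality; tri<; tri≈; tri>)
open import Relation.Binary.PropositionalEquality using (_≡_; _≢_; refl; sym; trans; cong; cong₂; subst; subst₂)
open import Relation.Nullary using (¬_; Dec; yes; no; does)
open import Relation.Nullary.Decidable using (¬?; dec-true; dec-false; _×-dec_; _⊎-dec_; _→-dec_; map′)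

-- Cycles as lists of vertices

module _ {A : Set} where

  Mem : A → List A → Set
  Mem x [] = ⊥
  Mem x (y ∷ r) = x ≡ y ⊎ Mem x r

  Distinct : List A → Set
  Distinct [] = ⊤
  Distinct (x ∷ r) = (¬ Mem x r) × Distinct r

  mem-++ˡ : ∀ {x} u v → Mem x u → Mem x (u ++ v)
  mem-++ˡ (y ∷ u) v (inj₁ e) = inj₁ e
  mem-++ˡ (y ∷ u) v (inj₂ m) = inj₂ (mem-++ˡ u v m)

  mem-++ʳ : ∀ {x} u v → Mem x v → Mem x (u ++ v)
  mem-++ʳ [] v m = m
  mem-++ʳ (y ∷ u) v m = inj₂ (mem-++ʳ u v m)

  mem-++⁻ : ∀ {x} u v → Mem x (u ++ v) → Mem x u ⊎ Mem x v
  mem-++⁻ [] v m = inj₂ m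
  mem-++⁻ (y ∷ u) v (inj₁ e) = inj₁ (inj₁ e)
  mem-++⁻ (y ∷ u) v (inj₂ m) with mem-++⁻ u v m
  ... | inj₁ m1 = inj₁ (inj₂ m1)
  ... | inj₂ m2 = inj₂ m2

  mem-split : ∀ {x} xs → Mem x xs → ∃₂ λ u w → xs ≡ u ++ x ∷ w
  mem-split (y ∷ r) (inj₁ refl) = [] , r , refl
  mem-split (y ∷ r) (inj₂ m) with mem-split r m
  ... | u , w , refl = y ∷ u , w , refl

  mem? : DecidableEquality A → ∀ x xs → Dec (Mem x xs)
  mem? _≟ᴬ_ x [] = no (λ ())
  mem? _≟ᴬ_ x (y ∷ r) = (x ≟ᴬ y) ⊎-dec mem? _≟ᴬ_ x r

  Disjoint : List A → List A → Set
  Disjoint u v = ∀ {x} → Mem x u → Mem x v → ⊥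

  distinct-++⁻ : ∀ u v → Distinct (u ++ v) → Distinct u × Distinct v × Disjoint u v
  distinct-++⁻ [] v d = tt , d , λ ()
  distinct-++⁻ (x ∷ u) v (x∉ , d) with distinct-++⁻ u v d
  ... | du , dv , dj = ((λ m → x∉ (mem-++ˡ u v m)) , du) , dv , dj′
    where
    dj′ : Disjoint (x ∷ u) v
    dj′ (inj₁ refl) mv = x∉ (mem-++ʳ u v mv)
    dj′ (inj₂ mu) mv = dj mu mv

  distinct-++⁺ : ∀ u v → Distinct u → Distinct v → Disjoint u v → Distinct (u ++ v)
  distinct-++⁺ [] v du dv dj = dv
  distinct-++⁺ (x ∷ u) v (x∉ , du) dv dj =
    (λ m → Sum.[ x∉ , dj (inj₁ refl) ]′ (mem-++⁻ u v m)) ,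
    distinct-++⁺ u v du dv (λ mu mv → dj (inj₂ mu) mv)

  distinct-++-comm : ∀ u v → Distinct (u ++ v) → Distinct (v ++ u)
  distinct-++-comm u v d with distinct-++⁻ u v d
  ... | du , dv , dj = distinct-++⁺ v u dv du (λ a b → dj b a)

  distinct-infix : ∀ u s w → Distinct (u ++ s ++ w) → Distinct s
  distinct-infix u s w d = proj₁ (distinct-++⁻ s w (proj₁ (proj₂ (distinct-++⁻ u (s ++ w) d))))

  -- A cycle is the list of its vertices in cyclic order: its edges are the steps
  -- between neighbours in the list and the step closing the list up.
  Step : List A → A → A → Set
  Step [] a b = ⊥
  Step (x ∷ []) a b = ⊥
  Step (x ∷ y ∷ r) a b = (x ≡ a × y ≡ b) ⊎ Step (y ∷ r) a b

  WrapStep : List A → A → A → Set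
  WrapStep xs a b = ∃ λ q → xs ≡ b ∷ q ++ [ a ]

  CyclicStep : List A → A → A → Set
  CyclicStep xs a b = Step xs a b ⊎ WrapStep xs a b

  CyclicEdge : List A → A → A → Set
  CyclicEdge xs a b = CyclicStep xs a b ⊎ CyclicStep xs b a

  CyclicEdge-sym : ∀ {xs a b} → CyclicEdge xs a b → CyclicEdge xs b a
  CyclicEdge-sym (inj₁ x) = inj₂ x
  CyclicEdge-sym (inj₂ y) = inj₁ y

  step⇒split : ∀ xs {a b} → Step xs a b → ∃₂ λ p q → xs ≡ p ++ a ∷ b ∷ q
  step⇒split (x ∷ y ∷ r) (inj₁ (refl , refl)) = [] , r , refl
  step⇒split (x ∷ y ∷ r) (inj₂ c) with step⇒split (y ∷ r) c
  ... | p , q , e = x ∷ p , q , cong (x ∷_) e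

  split⇒step : ∀ p {a b} q → Step (p ++ a ∷ b ∷ q) a b
  split⇒step [] q = inj₁ (refl , refl)
  split⇒step (x ∷ []) q = inj₂ (inj₁ (refl , refl))
  split⇒step (x ∷ y ∷ p) q = inj₂ (split⇒step (y ∷ p) q)

  step-at : ∀ {xs a b} p q → xs ≡ p ++ a ∷ b ∷ q → Step xs a b
  step-at p q refl = split⇒step p q

  step-mem : ∀ xs {a b} → Step xs a b → Mem a xs × Mem b xs
  step-mem (x ∷ y ∷ r) (inj₁ (refl , refl)) = inj₁ refl , inj₂ (inj₁ refl)
  step-mem (x ∷ y ∷ r) (inj₂ c) with step-mem (y ∷ r) c
  ... | m1 , m2 = inj₂ m1 , inj₂ m2

  step-mem-tail : ∀ x xs {a b} → Step (x ∷ xs) a b → Mem b xs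
  step-mem-tail x (y ∷ r) (inj₁ (refl , refl)) = inj₁ refl
  step-mem-tail x (y ∷ r) (inj₂ c) = inj₂ (step-mem-tail y r c)

  step-infix : ∀ u s w {a b} → Step s a b → Step (u ++ s ++ w) a b
  step-infix u s w c with step⇒split s c
  ... | p , q , refl = step-at (u ++ p) (q ++ w) eq
    where
    eq : u ++ (p ++ _ ∷ _ ∷ q) ++ w ≡ (u ++ p) ++ _ ∷ _ ∷ q ++ w
    eq = trans (cong (u ++_) (++-assoc p (_ ∷ _ ∷ q) w)) (sym (++-assoc u p _))

  init-last : ∀ (y : A) v → ∃₂ λ I l → y ∷ v ≡ I ++ [ l ]
  init-last y [] = [] , y , refl
  init-last y (z ∷ v) with init-last z v
  ... | I , l , e = y ∷ I , l , cong (y ∷_) e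

  StepInConcat : List A → List A → List A → A → A → List A → Set
  StepInConcat u v p a b q =
    (∃ λ q′ → u ≡ p ++ a ∷ b ∷ q′ × q ≡ q′ ++ v) ⊎
    (∃ λ p′ → v ≡ p′ ++ a ∷ b ∷ q × p ≡ u ++ p′) ⊎
    (u ≡ p ++ [ a ] × v ≡ b ∷ q)

  split-step-++ : ∀ (u v p : List A) {a b : A} (q : List A) → u ++ v ≡ p ++ a ∷ b ∷ q → StepInConcat u v p a b q
  split-step-++ [] v p q e = inj₂ (inj₁ (p , e , refl))
  split-step-++ (x ∷ []) v [] q refl = inj₂ (inj₂ (refl , refl))
  split-step-++ (x ∷ y ∷ u) v [] q refl = inj₁ (u , refl , refl)
  split-step-++ (x ∷ u) v (z ∷ p) q e with ∷-injective e
  ... | refl , e1 with split-step-++ u v p q e1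
  ... | inj₁ (q′ , refl , e3) = inj₁ (q′ , refl , e3)
  ... | inj₂ (inj₁ (p′ , e2 , refl)) = inj₂ (inj₁ (p′ , e2 , refl))
  ... | inj₂ (inj₂ (refl , e3)) = inj₂ (inj₂ (refl , e3))

  step-in-concat⇒rotated : ∀ (u v p : List A) {a b : A} (q : List A) → StepInConcat u v p a b q →
    CyclicStep (v ++ u) a b
  step-in-concat⇒rotated u v p q (inj₁ (q′ , refl , refl)) =
    inj₁ (step-at (v ++ p) q′ (sym (++-assoc v p _)))
  step-in-concat⇒rotated u v p q (inj₂ (inj₁ (p′ , refl , refl))) =
    inj₁ (step-at p′ (q ++ u) (++-assoc p′ (_ ∷ _ ∷ q) u))
  step-in-concat⇒rotated u v p q (inj₂ (inj₂ (refl , refl))) =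
    inj₂ (q ++ p , cong (_ ∷_) (sym (++-assoc q p _)))

  CyclicStep-rotate : ∀ u v {a b} → CyclicStep (u ++ v) a b → CyclicStep (v ++ u) a b
  CyclicStep-rotate u v (inj₁ c) with step⇒split (u ++ v) c
  ... | p , q , e = step-in-concat⇒rotated u v p q (split-step-++ u v p q e)
  CyclicStep-rotate [] v {a} {b} (inj₂ w) = inj₂ (subst (λ z → WrapStep z a b) (sym (++-identityʳ v)) w)
  CyclicStep-rotate (x ∷ u) [] {a} {b} (inj₂ w) = inj₂ (subst (λ z → WrapStep z a b) (++-identityʳ (x ∷ u)) w)
  CyclicStep-rotate (x ∷ u) (y ∷ v) (inj₂ (Q , e)) with init-last y v | ∷-injective e
  ... | I , l , e2 | refl , e3
    with ∷ʳ-injective (u ++ I) Q (trans (++-assoc u I [ l ]) (trans (cong (u ++_) (sym e2)) e3))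
  ... | _ , refl = inj₁ (step-at I u (trans (cong (_++ x ∷ u) e2) (++-assoc I [ l ] (x ∷ u))))

  CyclicEdge-rotate : ∀ u v {a b} → CyclicEdge (u ++ v) a b → CyclicEdge (v ++ u) a b
  CyclicEdge-rotate u v (inj₁ c) = inj₁ (CyclicStep-rotate u v c)
  CyclicEdge-rotate u v (inj₂ c) = inj₂ (CyclicStep-rotate u v c)

  CyclicStep-closed : ∀ a s b {x y} → CyclicStep (a ∷ s ++ [ b ]) x y →
    Step (a ∷ s ++ [ b ]) x y ⊎ (x ≡ b × y ≡ a)
  CyclicStep-closed a s b (inj₁ c) = inj₁ c
  CyclicStep-closed a s b (inj₂ (q , e)) with ∷-injective e
  ... | refl , e′ with ∷ʳ-injective s q e′
  ... | _ , refl = inj₂ (refl , refl)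

module _ {n : ℕ} where

  distinct? : ∀ (xs : List (Fin n)) → Dec (Distinct xs)
  distinct? [] = yes tt
  distinct? (x ∷ r) = ¬? (mem? _≟_ x r) ×-dec distinct? r

  step? : ∀ (xs : List (Fin n)) a b → Dec (Step xs a b)
  step? [] a b = no (λ ())
  step? (x ∷ []) a b = no (λ ())
  step? (x ∷ y ∷ r) a b = ((x ≟ a) ×-dec (y ≟ b)) ⊎-dec step? (y ∷ r) a b

  EndsWith : List (Fin n) → Fin n → Set
  EndsWith r a = ∃ λ q → r ≡ q ++ [ a ]

  ends? : ∀ r a → Dec (EndsWith r a)
  ends? [] a = no (λ { ([] , ()) ; (_ ∷ _ , ()) })
  ends? (z ∷ []) a with z ≟ a
  ... | yes refl = yes ([] , refl)
  ... | no ne = no (λ { ([] , refl) → ne refl ; (_ ∷ [] , ()) ; (_ ∷ _ ∷ _ , ()) })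
  ends? (z ∷ z′ ∷ r) a with ends? (z′ ∷ r) a
  ... | yes (q , e) = yes (z ∷ q , cong (z ∷_) e)
  ... | no ne = no (λ { ([] , ()) ; (_ ∷ q , e) → ne (q , proj₂ (∷-injective e)) })

  wrapStep? : ∀ (xs : List (Fin n)) a b → Dec (WrapStep xs a b)
  wrapStep? [] a b = no (λ { (_ , ()) })
  wrapStep? (y ∷ r) a b with y ≟ b | ends? r a
  ... | yes refl | yes (q , refl) = yes (q , refl)
  ... | no ne | _ = no (λ { (q , refl) → ne refl })
  ... | yes _ | no ne = no (λ { (q , refl) → ne (q , refl) })

  cyclicStep? : ∀ (xs : List (Fin n)) a b → Dec (CyclicStep xs a b)
  cyclicStep? xs a b = step? xs a b ⊎-dec wrapStep? xs a b

  cyclicEdge? : ∀ (xs : List (Fin n)) a b → Dec (CyclicEdge xs a b)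
  cyclicEdge? xs a b = cyclicStep? xs a b ⊎-dec cyclicStep? xs b a

  adj? : (K : Graph n) → ∀ a b → Dec (Adj K a b)
  adj? K a b = adj K a b BP.≟ true

  adj-irrefl : ∀ (K : Graph n) {a} → Adj K a a → ⊥
  adj-irrefl K {a} e with trans (sym e) (irrefl K a)
  ... | ()

  adj-sym : ∀ (K : Graph n) {a b} → Adj K a b → Adj K b a
  adj-sym K {a} {b} e = trans (Graph.sym K b a) e

  adj-≢ : ∀ (K : Graph n) {a b} → Adj K a b → a ≢ b
  adj-≢ K e refl = adj-irrefl K e

  StepsAdjacent : Graph n → List (Fin n) → Set
  StepsAdjacent K xs = ∀ a b → CyclicStep xs a b → Adj K a b

  stepsAdjacent? : ∀ K xs → Dec (StepsAdjacent K xs)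
  stepsAdjacent? K xs = all? (λ a → all? (λ b → cyclicStep? xs a b →-dec adj? K a b))

  IsCycle : Graph n → List (Fin n) → Set
  IsCycle K xs = Distinct xs × 3 ≤ length xs × StepsAdjacent K xs

  isCycle? : ∀ K xs → Dec (IsCycle K xs)
  isCycle? K xs = distinct? xs ×-dec ((3 ≤? length xs) ×-dec stepsAdjacent? K xs)

  DisjointOrEqual : Graph n → List (Fin n) → List (Fin n) → Set
  DisjointOrEqual K xs ys = IsCycle K xs → IsCycle K ys →
    ∀ u v → CyclicEdge xs u v → CyclicEdge ys u v → ∀ a b → CyclicEdge xs a b → CyclicEdge ys a b

  CactusCycles : Graph n → Set
  CactusCycles K = ∀ xs ys → DisjointOrEqual K xs ys

  cyclicEdge⇒adj : ∀ K xs → StepsAdjacent K xs → ∀ {a b} → CyclicEdge xs a b → Adj K a b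
  cyclicEdge⇒adj K xs ac (inj₁ c) = ac _ _ c
  cyclicEdge⇒adj K xs ac (inj₂ c) = trans (Graph.sym K _ _) (ac _ _ c)

-- Cycle lists versus the cycles of the statement

module _ {A : Set} where

  next-inj₁ : ∀ {k} (j : Fin k) → next (inject₁ j) ≡ suc j
  next-inj₁ {k} j = toℕ-injective (trans (toℕ-fromℕ< _)
    (trans (m<n⇒m%n≡m {n = suc k} (s≤s (subst (_< k) (sym (toℕ-inject₁ j)) (toℕ<n j))))
      (cong suc (toℕ-inject₁ j))))

  next-last : ∀ k → next (fromℕ k) ≡ zero
  next-last k = toℕ-injective (trans (toℕ-fromℕ< _)
    (trans (cong (λ z → suc z % suc k) (toℕ-fromℕ k)) (n%n≡0 (suc k))))

  fin-cases : ∀ {k} (i : Fin (suc k)) → (∃ λ j → i ≡ inject₁ j) ⊎ i ≡ fromℕ k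
  fin-cases {zero} zero = inj₂ refl
  fin-cases {suc k} zero = inj₁ (zero , refl)
  fin-cases {suc k} (suc i) with fin-cases i
  ... | inj₁ (j , refl) = inj₁ (suc j , refl)
  ... | inj₂ refl = inj₂ refl

  step-tabulate⁻ : ∀ {k} (F : Fin (suc k) → A) {a b} → Step (tabulate F) a b →
    ∃ λ (j : Fin k) → F (inject₁ j) ≡ a × F (suc j) ≡ b
  step-tabulate⁻ {suc k} F (inj₁ (e1 , e2)) = zero , e1 , e2
  step-tabulate⁻ {suc k} F (inj₂ c) with step-tabulate⁻ (F ∘ suc) c
  ... | j , e1 , e2 = suc j , e1 , e2

  step-tabulate⁺ : ∀ {k} (F : Fin (suc k) → A) (j : Fin k) → Step (tabulate F) (F (inject₁ j)) (F (suc j))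
  step-tabulate⁺ {suc k} F zero = inj₁ (refl , refl)
  step-tabulate⁺ {suc k} F (suc j) = inj₂ (step-tabulate⁺ (F ∘ suc) j)

  tabulate-∷ʳ : ∀ {k} (F : Fin (suc k) → A) → tabulate F ≡ tabulate (F ∘ inject₁) ++ [ F (fromℕ k) ]
  tabulate-∷ʳ {zero} F = refl
  tabulate-∷ʳ {suc k} F = cong (F zero ∷_) (tabulate-∷ʳ (F ∘ suc))

  wrapStep-tabulate⁻ : ∀ {k} (F : Fin (suc (suc k)) → A) {a b} → WrapStep (tabulate F) a b →
    F zero ≡ b × F (fromℕ (suc k)) ≡ a
  wrapStep-tabulate⁻ {k} F (q , e) with ∷-injective e
  ... | e1 , e2 = e1 , proj₂ (∷ʳ-injective _ q (trans (sym (tabulate-∷ʳ (F ∘ suc))) e2))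

  wrapStep-tabulate⁺ : ∀ {k} (F : Fin (suc (suc k)) → A) → WrapStep (tabulate F) (F (fromℕ (suc k))) (F zero)
  wrapStep-tabulate⁺ {k} F = tabulate ((F ∘ suc) ∘ inject₁) , cong (F zero ∷_) (tabulate-∷ʳ (F ∘ suc))

  cyclicStep-tabulate⁻ : ∀ {k} (F : Fin (suc (suc k)) → A) {a b} → CyclicStep (tabulate F) a b →
    ∃ λ i → F i ≡ a × F (next i) ≡ b
  cyclicStep-tabulate⁻ F (inj₁ c) with step-tabulate⁻ F c
  ... | j , e1 , e2 = inject₁ j , e1 , trans (cong F (next-inj₁ j)) e2
  cyclicStep-tabulate⁻ {k} F (inj₂ w) with wrapStep-tabulate⁻ F w
  ... | e1 , e2 = fromℕ (suc k) , e2 , trans (cong F (next-last (suc k))) e1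

  cyclicStep-tabulate⁺ : ∀ {k} (F : Fin (suc (suc k)) → A) i → CyclicStep (tabulate F) (F i) (F (next i))
  cyclicStep-tabulate⁺ {k} F i with fin-cases i
  ... | inj₁ (j , refl) =
    inj₁ (subst (Step (tabulate F) (F (inject₁ j)) ∘ F) (sym (next-inj₁ j)) (step-tabulate⁺ F j))
  ... | inj₂ refl =
    inj₂ (subst (WrapStep (tabulate F) (F (fromℕ (suc k))) ∘ F) (sym (next-last (suc k))) (wrapStep-tabulate⁺ F))

  mem-tabulate⁻ : ∀ {k} (F : Fin k → A) {a} → Mem a (tabulate F) → ∃ λ i → a ≡ F i
  mem-tabulate⁻ {suc k} F (inj₁ e) = zero , e
  mem-tabulate⁻ {suc k} F (inj₂ m) with mem-tabulate⁻ (F ∘ suc) m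
  ... | i , e = suc i , e

  mem-tabulate⁺ : ∀ {k} (F : Fin k → A) i → Mem (F i) (tabulate F)
  mem-tabulate⁺ F zero = inj₁ refl
  mem-tabulate⁺ F (suc i) = inj₂ (mem-tabulate⁺ (F ∘ suc) i)

  distinct-tabulate : ∀ {k} (F : Fin k → A) → (∀ {i j} → F i ≡ F j → i ≡ j) → Distinct (tabulate F)
  distinct-tabulate {zero} F F-inj = tt
  distinct-tabulate {suc k} F F-inj =
    (λ m → 0≢1+n (F-inj (proj₂ (mem-tabulate⁻ (F ∘ suc) m)))) ,
    distinct-tabulate (F ∘ suc) (suc-injective ∘ F-inj)

  mem-lookup : ∀ (xs : List A) i → Mem (lookup xs i) xs
  mem-lookup (x ∷ xs) zero = inj₁ refl
  mem-lookup (x ∷ xs) (suc i) = inj₂ (mem-lookup xs i)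

  lookup-injective : ∀ (xs : List A) → Distinct xs → ∀ {i j} → lookup xs i ≡ lookup xs j → i ≡ j
  lookup-injective (x ∷ xs) d {zero} {zero} e = refl
  lookup-injective (x ∷ xs) (x∉ , d) {zero} {suc j} e = ⊥-elim (x∉ (subst (λ z → Mem z xs) (sym e) (mem-lookup xs j)))
  lookup-injective (x ∷ xs) (x∉ , d) {suc i} {zero} e = ⊥-elim (x∉ (subst (λ z → Mem z xs) e (mem-lookup xs i)))
  lookup-injective (x ∷ xs) (_ , d) {suc i} {suc j} e = cong suc (lookup-injective xs d e)

module _ {n : ℕ} where

  FunCycleEdge : ∀ {m} (F : Fin (3 + m) → Fin n) → Fin n → Fin n → Set
  FunCycleEdge F a b = ∃ λ i → (F i ≡ a × F (next i) ≡ b) ⊎ (F i ≡ b × F (next i) ≡ a)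

  cyclicEdge-tabulate⁻ : ∀ {m} (F : Fin (3 + m) → Fin n) {a b} → CyclicEdge (tabulate F) a b → FunCycleEdge F a b
  cyclicEdge-tabulate⁻ F (inj₁ c) with cyclicStep-tabulate⁻ F c
  ... | i , e1 , e2 = i , inj₁ (e1 , e2)
  cyclicEdge-tabulate⁻ F (inj₂ c) with cyclicStep-tabulate⁻ F c
  ... | i , e1 , e2 = i , inj₂ (e1 , e2)

  cyclicEdge-tabulate⁺ : ∀ {m} (F : Fin (3 + m) → Fin n) {a b} → FunCycleEdge F a b → CyclicEdge (tabulate F) a b
  cyclicEdge-tabulate⁺ F (i , inj₁ (refl , refl)) = inj₁ (cyclicStep-tabulate⁺ F i)
  cyclicEdge-tabulate⁺ F (i , inj₂ (refl , refl)) = inj₂ (cyclicStep-tabulate⁺ F i)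

  cycle⇒isCycle : ∀ {K : Graph n} {m} (C : Cycle K m) → IsCycle K (tabulate (vert C))
  cycle⇒isCycle {K} {m} C = distinct-tabulate (vert C) (inj C) ,
    subst (3 ≤_) (sym (length-tabulate (vert C))) (s≤s (s≤s (s≤s z≤n))) ,
    λ a b c → let (i , e1 , e2) = cyclicStep-tabulate⁻ (vert C) c in
      subst₂ (Adj K) e1 e2 (edges C i)

  isCycle⇒cycle : ∀ {K : Graph n} xs → IsCycle K xs → Σ ℕ λ m → (length xs ≡ 3 + m) × Σ (Cycle K m) λ C →
    (∀ a b → CycleEdge C a b → CyclicEdge xs a b) × (∀ a b → CyclicEdge xs a b → CycleEdge C a b)
  isCycle⇒cycle {K} (x1 ∷ x2 ∷ x3 ∷ r) (d , _ , ac) =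
    length r , refl ,
    record
      { vert = lookup xs
      ; inj = lookup-injective xs d
      ; edges = λ i → ac _ _ (subst (λ z → CyclicStep z (lookup xs i) (lookup xs (next i)))
                                    (tabulate-lookup xs) (cyclicStep-tabulate⁺ (lookup xs) i))
      } ,
    (λ a b e → subst (λ z → CyclicEdge z a b) (tabulate-lookup xs) (cyclicEdge-tabulate⁺ (lookup xs) e)) ,
    (λ a b e → cyclicEdge-tabulate⁻ (lookup xs) (subst (λ z → CyclicEdge z a b) (sym (tabulate-lookup xs)) e))
    where
    xs : List (Fin n)
    xs = x1 ∷ x2 ∷ x3 ∷ r
  isCycle⇒cycle [] (_ , () , _)
  isCycle⇒cycle (_ ∷ []) (_ , s≤s () , _)
  isCycle⇒cycle (_ ∷ _ ∷ []) (_ , s≤s (s≤s ()) , _)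

  cactus⇒cactusCycles : ∀ {K : Graph n} → Cactus K → CactusCycles K
  cactus⇒cactusCycles {K} (_ , unique) xs ys cx cy u v uv₁ uv₂ a b ab
    with isCycle⇒cycle xs cx | isCycle⇒cycle ys cy
  ... | m₁ , _ , C₁ , _ , from₁ | m₂ , _ , C₂ , to₂ , from₂ =
    to₂ a b (Equivalence.to (unique u v (cyclicEdge⇒adj K xs (proj₂ (proj₂ cx)) uv₁) m₁ m₂ C₁ C₂
      (from₁ u v uv₁) (from₂ u v uv₂) a b) (from₁ a b ab))

  cactusCycles⇒cactus : ∀ {K : Graph n} → Connected K → CactusCycles K → Cactus K
  cactusCycles⇒cactus {K} conn ccl = conn , λ u v _ _ _ C₁ C₂ uv₁ uv₂ a b →
    mk⇔ (transfer C₁ C₂ uv₁ uv₂) (transfer C₂ C₁ uv₂ uv₁)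
    where
    transfer : ∀ {m₁ m₂ u v a b} (C₁ : Cycle K m₁) (C₂ : Cycle K m₂) →
      CycleEdge C₁ u v → CycleEdge C₂ u v → CycleEdge C₁ a b → CycleEdge C₂ a b
    transfer C₁ C₂ uv₁ uv₂ ab = cyclicEdge-tabulate⁻ (vert C₂)
      (ccl _ _ (cycle⇒isCycle C₁) (cycle⇒isCycle C₂) _ _ (cyclicEdge-tabulate⁺ (vert C₁) uv₁)
        (cyclicEdge-tabulate⁺ (vert C₂) uv₂) _ _ (cyclicEdge-tabulate⁺ (vert C₁) ab))

-- Counting edges

module _ {X : Set} where

  sum-map-mono : ∀ (L : List X) (f g : X → ℕ) → (∀ x → Mem x L → f x ≤ g x) →
    sum (map f L) ≤ sum (map g L)
  sum-map-mono [] f g h = z≤n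
  sum-map-mono (x ∷ L) f g h = +-mono-≤ (h x (inj₁ refl)) (sum-map-mono L f g (λ y m → h y (inj₂ m)))

  sum-map-mono-< : ∀ (L : List X) (f g : X → ℕ) → (∀ x → Mem x L → f x ≤ g x) →
    ∀ x₀ → Mem x₀ L → f x₀ < g x₀ → sum (map f L) < sum (map g L)
  sum-map-mono-< (x ∷ L) f g h x₀ (inj₁ refl) lt = +-mono-≤ lt (sum-map-mono L f g (λ y m → h y (inj₂ m)))
  sum-map-mono-< (x ∷ L) f g h x₀ (inj₂ m) lt =
    subst (_≤ g x + sum (map g L)) (+-suc (f x) (sum (map f L)))
      (+-mono-≤ (h x (inj₁ refl)) (sum-map-mono-< L f g (λ y m → h y (inj₂ m)) x₀ m lt))

  sum-map-≤-* : ∀ (L : List X) (f : X → ℕ) c → (∀ x → f x ≤ c) → sum (map f L) ≤ length L * c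
  sum-map-≤-* [] f c h = z≤n
  sum-map-≤-* (x ∷ L) f c h = +-mono-≤ (h x) (sum-map-≤-* L f c h)

  sum-map-≤-suc : DecidableEquality X → ∀ (L : List X) (f g : X → ℕ) x₀ → Distinct L →
    (∀ x → Mem x L → x ≢ x₀ → f x ≤ g x) → f x₀ ≤ suc (g x₀) →
    sum (map f L) ≤ suc (sum (map g L))
  sum-map-≤-suc _≟ˣ_ [] f g x₀ d h h₀ = z≤n
  sum-map-≤-suc _≟ˣ_ (x ∷ L) f g x₀ (x∉ , d) h h₀ with x ≟ˣ x₀
  ... | yes refl = +-mono-≤ h₀ (sum-map-mono L f g (λ y m → h y (inj₂ m) (λ { refl → x∉ m })))
  ... | no x≢x₀ = ≤-trans (+-mono-≤ (h x (inj₁ refl) x≢x₀) (sum-map-≤-suc _≟ˣ_ L f g x₀ d (λ y m → h y (inj₂ m)) h₀))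
                          (≤-reflexive (+-suc (g x) _))

indicator : Bool → Bool → ℕ
indicator c b = if c ∧ b then 1 else 0

indicator≤1 : ∀ c b → indicator c b ≤ 1
indicator≤1 false b = z≤n
indicator≤1 true false = z≤n
indicator≤1 true true = s≤s z≤n

indicator-mono : ∀ c {b b′} → (b ≡ true → b′ ≡ true) → indicator c b ≤ indicator c b′
indicator-mono false h = z≤n
indicator-mono true {false} h = z≤n
indicator-mono true {true} h rewrite h refl = s≤s z≤n

<⇒<ᵇ≡true : ∀ m k → m < k → (m <ᵇ k) ≡ true
<⇒<ᵇ≡true m k m<k = Equivalence.to BP.T-≡ (<⇒<ᵇ m<k)

≤⇒<ᵇ≡false : ∀ m k → k ≤ m → (m <ᵇ k) ≡ false
≤⇒<ᵇ≡false m k k≤m = BP.¬-not (λ m<ᵇk → <⇒≱ (<ᵇ⇒< m k (Equivalence.from BP.T-≡ m<ᵇk)) k≤m)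

module _ {n : ℕ} where

  -- numEdges K unfolds to sum (map (edgesAbove K) (allFin n)).
  edgesAbove : Graph n → Fin n → ℕ
  edgesAbove K i = sum (map (λ j → indicator (toℕ i <ᵇ toℕ j) (adj K i j)) (allFin n))

  mem-allFin : ∀ (i : Fin n) → Mem i (allFin n)
  mem-allFin i = mem-tabulate⁺ id i

  distinct-allFin : Distinct (allFin n)
  distinct-allFin = distinct-tabulate id id

  numEdges-mono : ∀ (A B : Graph n) → Subgraph A B → numEdges A ≤ numEdges B
  numEdges-mono A B s = sum-map-mono (allFin n) (edgesAbove A) (edgesAbove B) (λ i _ →
    sum-map-mono (allFin n) _ _ (λ j _ → indicator-mono (toℕ i <ᵇ toℕ j) (s i j)))

  numEdges-<-ordered : ∀ (A B : Graph n) → Subgraph A B → ∀ x y → toℕ x < toℕ y → Adj B x y → ¬ Adj A x y →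
    numEdges A < numEdges B
  numEdges-<-ordered A B A⊆B x y x<y bxy ¬axy =
    sum-map-mono-< (allFin n) (edgesAbove A) (edgesAbove B)
      (λ i _ → sum-map-mono (allFin n) _ _ (λ j _ → indicator-mono (toℕ i <ᵇ toℕ j) (A⊆B i j)))
      x (mem-allFin x)
      (sum-map-mono-< (allFin n) _ _ (λ j _ → indicator-mono (toℕ x <ᵇ toℕ j) (A⊆B x j)) y (mem-allFin y) new-edge)
    where
    new-edge : indicator (toℕ x <ᵇ toℕ y) (adj A x y) < indicator (toℕ x <ᵇ toℕ y) (adj B x y)
    new-edge rewrite <⇒<ᵇ≡true _ _ x<y | BP.¬-not ¬axy | bxy = s≤s z≤n

  numEdges-< : ∀ (A B : Graph n) → Subgraph A B → ∀ x y → Adj B x y → ¬ Adj A x y → numEdges A < numEdges B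
  numEdges-< A B A⊆B x y bxy ¬axy with <-cmp (toℕ x) (toℕ y)
  ... | tri< x<y _ _ = numEdges-<-ordered A B A⊆B x y x<y bxy ¬axy
  ... | tri≈ _ x≡y _ = ⊥-elim (adj-≢ B bxy (toℕ-injective x≡y))
  ... | tri> _ _ y<x = numEdges-<-ordered A B A⊆B y x y<x (adj-sym B bxy) (¬axy ∘ adj-sym A)

  SamePair : Fin n → Fin n → Fin n → Fin n → Set
  SamePair p q a b = (a ≡ p × b ≡ q) ⊎ (a ≡ q × b ≡ p)

  samePair? : ∀ p q a b → Dec (SamePair p q a b)
  samePair? p q a b = ((a ≟ p) ×-dec (b ≟ q)) ⊎-dec ((a ≟ q) ×-dec (b ≟ p))

  SamePair-flip : ∀ {p q a b} → SamePair p q a b → SamePair p q b a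
  SamePair-flip (inj₁ (e1 , e2)) = inj₂ (e2 , e1)
  SamePair-flip (inj₂ (e1 , e2)) = inj₁ (e2 , e1)

  SamePair-swap : ∀ {p q a b} → SamePair p q a b → SamePair q p a b
  SamePair-swap (inj₁ x) = inj₂ x
  SamePair-swap (inj₂ y) = inj₁ y

  numEdges-≤-suc-ordered : ∀ A B p q → toℕ p ≤ toℕ q →
    (∀ a b → Adj A a b → Adj B a b ⊎ SamePair p q a b) → numEdges A ≤ suc (numEdges B)
  numEdges-≤-suc-ordered A B p q le h =
    sum-map-≤-suc _≟_ (allFin n) (edgesAbove A) (edgesAbove B) p distinct-allFin
      (λ i _ i≢p → sum-map-mono (allFin n) _ _ (λ j _ → entry-≤ i j (inj₁ i≢p)))
      (sum-map-≤-suc _≟_ (allFin n) _ _ q distinct-allFin (λ j _ j≢q → entry-≤ p j (inj₂ j≢q))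
        (≤-trans (indicator≤1 (toℕ p <ᵇ toℕ q) (adj A p q)) (s≤s z≤n)))
    where
    -- Away from the entry (p , q) the count cannot go up; the entry (q , p) is not counted.
    entry-≤ : ∀ i j → i ≢ p ⊎ j ≢ q →
      indicator (toℕ i <ᵇ toℕ j) (adj A i j) ≤ indicator (toℕ i <ᵇ toℕ j) (adj B i j)
    entry-≤ i j off-pq with adj A i j in eq
    ... | false = indicator-mono (toℕ i <ᵇ toℕ j) (λ ())
    ... | true with h i j eq
    ...   | inj₁ b rewrite b = indicator-mono (toℕ i <ᵇ toℕ j) (λ _ → refl)
    ...   | inj₂ (inj₁ (refl , refl)) = ⊥-elim (Sum.[ (λ i≢p → i≢p refl) , (λ j≢q → j≢q refl) ]′ off-pq)
    entry-≤ i j off-pq | true | inj₂ (inj₂ (refl , refl)) rewrite ≤⇒<ᵇ≡false (toℕ q) (toℕ p) le = z≤n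

  numEdges-≤-suc : ∀ A B p q → (∀ a b → Adj A a b → Adj B a b ⊎ SamePair p q a b) →
    numEdges A ≤ suc (numEdges B)
  numEdges-≤-suc A B p q h with ≤-total (toℕ p) (toℕ q)
  ... | inj₁ le = numEdges-≤-suc-ordered A B p q le h
  ... | inj₂ le = numEdges-≤-suc-ordered A B q p le (λ a b e → Sum.map₂ SamePair-swap (h a b e))

  length-allFin : length (allFin n) ≡ n
  length-allFin = length-tabulate {n = n} (λ (i : Fin n) → i)

  numEdges≤n² : ∀ (K : Graph n) → numEdges K ≤ n * n
  numEdges≤n² K = subst (λ z → sum (map (edgesAbove K) (allFin n)) ≤ z * n) length-allFin
    (sum-map-≤-* (allFin n) (edgesAbove K) n edgesAbove≤n)
    where
    edgesAbove≤n : ∀ i → edgesAbove K i ≤ n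
    edgesAbove≤n i = subst (edgesAbove K i ≤_) (trans (cong (_* 1) length-allFin) (*-identityʳ n))
      (sum-map-≤-* (allFin n) _ 1 (λ j → indicator≤1 (toℕ i <ᵇ toℕ j) (adj K i j)))

-- Finite search

mem-map : ∀ {X Y : Set} (f : X → Y) {x} L → Mem x L → Mem (f x) (map f L)
mem-map f (y ∷ L) (inj₁ refl) = inj₁ refl
mem-map f (y ∷ L) (inj₂ m) = inj₂ (mem-map f L m)

module _ {X : Set} where

  allMem? : ∀ {P : X → Set} (L : List X) → (∀ x → Dec (P x)) → Dec (∀ x → Mem x L → P x)
  allMem? [] P? = yes (λ x ())
  allMem? {P} (y ∷ L) P? with P? y | allMem? L P?
  ... | no np | _ = no (λ h → np (h y (inj₁ refl)))
  ... | yes p | no nh = no (λ h → nh (λ x m → h x (inj₂ m)))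
  ... | yes p | yes h = yes (λ { x (inj₁ refl) → p ; x (inj₂ m) → h x m })

  anyMem? : ∀ {P : X → Set} (L : List X) → (∀ x → Dec (P x)) → Dec (∃ λ x → Mem x L × P x)
  anyMem? [] P? = no (λ { (_ , () , _) })
  anyMem? {P} (y ∷ L) P? with P? y | anyMem? L P?
  ... | yes p | _ = yes (y , inj₁ refl , p)
  ... | no np | yes (x , m , p) = yes (x , inj₂ m , p)
  ... | no np | no nh = no (λ { (x , inj₁ refl , p) → np p ; (x , inj₂ m , p) → nh (x , m , p) })

  filterBy : (X → Bool) → List X → List X
  filterBy f [] = []
  filterBy f (x ∷ L) with f x
  ... | true = x ∷ filterBy f L
  ... | false = filterBy f L

  filterBy-mem⁻ : ∀ f L {x} → Mem x (filterBy f L) → f x ≡ true × Mem x L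
  filterBy-mem⁻ f (y ∷ L) m with f y in eq
  filterBy-mem⁻ f (y ∷ L) (inj₁ refl) | true = eq , inj₁ refl
  filterBy-mem⁻ f (y ∷ L) (inj₂ m) | true = proj₁ (filterBy-mem⁻ f L m) , inj₂ (proj₂ (filterBy-mem⁻ f L m))
  filterBy-mem⁻ f (y ∷ L) m | false = proj₁ (filterBy-mem⁻ f L m) , inj₂ (proj₂ (filterBy-mem⁻ f L m))

  filterBy-mem⁺ : ∀ f L {x} → f x ≡ true → Mem x L → Mem x (filterBy f L)
  filterBy-mem⁺ f (y ∷ L) {x} fx m with f y in eq
  filterBy-mem⁺ f (y ∷ L) {x} fx (inj₁ refl) | true = inj₁ refl
  filterBy-mem⁺ f (y ∷ L) {x} fx (inj₂ m) | true = inj₂ (filterBy-mem⁺ f L fx m)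
  filterBy-mem⁺ f (y ∷ L) {x} fx (inj₁ refl) | false with trans (sym fx) eq
  ... | ()
  filterBy-mem⁺ f (y ∷ L) {x} fx (inj₂ m) | false = filterBy-mem⁺ f L fx m

  sublists : List X → List (List X)
  sublists [] = [] ∷ []
  sublists (x ∷ L) = map (x ∷_) (sublists L) ++ sublists L

  filterBy-sublists : ∀ f L → Mem (filterBy f L) (sublists L)
  filterBy-sublists f [] = inj₁ refl
  filterBy-sublists f (x ∷ L) with f x
  ... | true = mem-++ˡ (map (x ∷_) (sublists L)) (sublists L) (mem-map (x ∷_) (sublists L) (filterBy-sublists f L))
  ... | false = mem-++ʳ (map (x ∷_) (sublists L)) (sublists L) (filterBy-sublists f L)

  maximise : ∀ (L : List X) (P : X → Set) (P? : ∀ x → Dec (P x)) (f : X → ℕ) b → P b →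
    ∃ λ x → P x × f b ≤ f x × (∀ y → Mem y L → P y → f y ≤ f x)
  maximise [] P P? f b pb = b , pb , ≤-refl , (λ y ())
  maximise (y ∷ L) P P? f b pb with P? y
  ... | no npy = let (x , px , bx , h) = maximise L P P? f b pb in
    x , px , bx , (λ { z (inj₁ refl) pz → ⊥-elim (npy pz) ; z (inj₂ m) pz → h z m pz })
  ... | yes py with f b ≤? f y
  ...   | yes le = let (x , px , yx , h) = maximise L P P? f y py in
    x , px , ≤-trans le yx , (λ { z (inj₁ refl) pz → yx ; z (inj₂ m) pz → h z m pz })
  ...   | no nle = let (x , px , bx , h) = maximise L P P? f b pb in
    x , px , bx , (λ { z (inj₁ refl) pz → ≤-trans (<⇒≤ (≰⇒> nle)) bx ; z (inj₂ m) pz → h z m pz })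

-- Graph constructions and the score

does-true⇒ : ∀ {P : Set} (d : Dec P) → does d ≡ true → P
does-true⇒ (yes p) _ = p

does-cong : ∀ {P Q : Set} (d : Dec P) (e : Dec Q) → (P → Q) → (Q → P) → does d ≡ does e
does-cong (yes p) (yes q) f g = refl
does-cong (yes p) (no nq) f g = ⊥-elim (nq (f p))
does-cong (no np) (yes q) f g = ⊥-elim (np (g q))
does-cong (no np) (no nq) f g = refl

module _ {n : ℕ} where

  graphFrom : (R : Fin n → Fin n → Set) → (∀ a b → Dec (R a b)) →
    (∀ {a b} → R a b → R b a) → (∀ {a} → ¬ R a a) → Graph n
  graphFrom R R? R-sym R-irrefl = record
    { adj = λ a b → does (R? a b)
    ; sym = λ a b → does-cong (R? a b) (R? b a) R-sym R-sym
    ; irrefl = λ a → dec-false (R? a a) R-irrefl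
    }

  SamePair-loop : ∀ {p q a : Fin n} → SamePair p q a a → p ≡ q
  SamePair-loop (inj₁ (refl , refl)) = refl
  SamePair-loop (inj₂ (refl , refl)) = refl

  addEdge? : ∀ (K : Graph n) p q a b → Dec (Adj K a b ⊎ SamePair p q a b)
  addEdge? K p q a b = adj? K a b ⊎-dec samePair? p q a b

  addEdge : (K : Graph n) (p q : Fin n) → p ≢ q → Graph n
  addEdge K p q p≢q = graphFrom (λ a b → Adj K a b ⊎ SamePair p q a b) (addEdge? K p q)
    (Sum.map (adj-sym K) SamePair-flip)
    (λ { (inj₁ e) → adj-irrefl K e ; (inj₂ pp) → p≢q (SamePair-loop pp) })

  addEdge⁻ : ∀ K p q (p≢q : p ≢ q) {a b} → Adj (addEdge K p q p≢q) a b → Adj K a b ⊎ SamePair p q a b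
  addEdge⁻ K p q _ {a} {b} = does-true⇒ (addEdge? K p q a b)

  addEdge⁺ : ∀ K p q (p≢q : p ≢ q) {a b} → Adj K a b ⊎ SamePair p q a b → Adj (addEdge K p q p≢q) a b
  addEdge⁺ K p q _ {a} {b} = dec-true (addEdge? K p q a b)

  addEdge-subgraph : ∀ (H G : Graph n) {p q} (p≢q : p ≢ q) → Subgraph H G → Adj G p q →
    Subgraph (addEdge H p q p≢q) G
  addEdge-subgraph H G {p} {q} p≢q H⊆G pq a b e with addEdge⁻ H p q p≢q e
  ... | inj₁ h = H⊆G a b h
  ... | inj₂ (inj₁ (refl , refl)) = pq
  ... | inj₂ (inj₂ (refl , refl)) = adj-sym G pq

  removeEdge? : ∀ (K : Graph n) p q a b → Dec (Adj K a b × ¬ SamePair p q a b)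
  removeEdge? K p q a b = adj? K a b ×-dec ¬? (samePair? p q a b)

  removeEdge : (K : Graph n) (p q : Fin n) → Graph n
  removeEdge K p q = graphFrom (λ a b → Adj K a b × ¬ SamePair p q a b) (removeEdge? K p q)
    (λ (e , ¬pq) → adj-sym K e , ¬pq ∘ SamePair-flip)
    (adj-irrefl K ∘ proj₁)

  removeEdge⁻ : ∀ K p q {a b} → Adj (removeEdge K p q) a b → Adj K a b × ¬ SamePair p q a b
  removeEdge⁻ K p q {a} {b} = does-true⇒ (removeEdge? K p q a b)

  removeEdge⁺ : ∀ K p q {a b} → Adj K a b × ¬ SamePair p q a b → Adj (removeEdge K p q) a b
  removeEdge⁺ K p q {a} {b} = dec-true (removeEdge? K p q a b)

  InTriangle : Graph n → Fin n → Fin n → Set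
  InTriangle K a b = Adj K a b × ∃ λ w → Adj K a w × Adj K w b

  inTriangle? : ∀ (K : Graph n) a b → Dec (InTriangle K a b)
  inTriangle? K a b = adj? K a b ×-dec any? (λ w → adj? K a w ×-dec adj? K w b)

  triangleEdges : Graph n → Graph n
  triangleEdges K = graphFrom (InTriangle K) (inTriangle? K)
    (λ (ab , w , aw , wb) → adj-sym K ab , w , adj-sym K wb , adj-sym K aw)
    (adj-irrefl K ∘ proj₁)

  triangleEdges⁻ : ∀ (K : Graph n) {a b} → Adj (triangleEdges K) a b → InTriangle K a b
  triangleEdges⁻ K {a} {b} = does-true⇒ (inTriangle? K a b)

  triangleEdges⁺ : ∀ (K : Graph n) {a b} → InTriangle K a b → Adj (triangleEdges K) a b
  triangleEdges⁺ K {a} {b} = dec-true (inTriangle? K a b)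

  triangleEdges-mono : ∀ (A B : Graph n) → Subgraph A B → Subgraph (triangleEdges A) (triangleEdges B)
  triangleEdges-mono A B A⊆B a b e with triangleEdges⁻ A e
  ... | ab , w , aw , wb = triangleEdges⁺ B (A⊆B _ _ ab , w , A⊆B _ _ aw , A⊆B _ _ wb)

  numTriangleEdges : Graph n → ℕ
  numTriangleEdges K = numEdges (triangleEdges K)

  numTriangleEdges≤numEdges : ∀ (K : Graph n) → numTriangleEdges K ≤ numEdges K
  numTriangleEdges≤numEdges K = numEdges-mono (triangleEdges K) K (λ a b e → proj₁ (triangleEdges⁻ K e))

  -- Orders graphs by edges first and triangle edges second, as numTriangleEdges ≤ n * n < scoreBase.
  scoreBase : ℕ
  scoreBase = suc (n * n)

  score : Graph n → ℕ
  score K = numEdges K * scoreBase + numTriangleEdges K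

  numEdges-cong : ∀ (A B : Graph n) → Subgraph A B → Subgraph B A → numEdges A ≡ numEdges B
  numEdges-cong A B A⊆B B⊆A = ≤-antisym (numEdges-mono A B A⊆B) (numEdges-mono B A B⊆A)

  score-cong : ∀ (A B : Graph n) → Subgraph A B → Subgraph B A → score A ≡ score B
  score-cong A B A⊆B B⊆A = cong₂ (λ e t → e * scoreBase + t) (numEdges-cong A B A⊆B B⊆A)
    (numEdges-cong (triangleEdges A) (triangleEdges B) (triangleEdges-mono A B A⊆B) (triangleEdges-mono B A B⊆A))

  isCycle-mono : ∀ (A B : Graph n) → Subgraph A B → ∀ xs → IsCycle A xs → IsCycle B xs
  isCycle-mono A B A⊆B xs (d , l , ac) = d , l , (λ a b c → A⊆B a b (ac a b c))

  cactusCycles-antimono : ∀ (A B : Graph n) → Subgraph B A → CactusCycles A → CactusCycles B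
  cactusCycles-antimono A B B⊆A ccl xs ys lx ly =
    ccl xs ys (isCycle-mono B A B⊆A xs lx) (isCycle-mono B A B⊆A ys ly)

  Selected : List (Fin n × Fin n) → Fin n → Fin n → Set
  Selected S a b = Mem (a , b) S ⊎ Mem (b , a) S

  selectEdge? : ∀ (G : Graph n) S a b → Dec (Adj G a b × Selected S a b)
  selectEdge? G S a b = adj? G a b ×-dec (mem? pair-≟ (a , b) S ⊎-dec mem? pair-≟ (b , a) S)
    where
    pair-≟ = ≡-dec _≟_ _≟_

  selectEdges : Graph n → List (Fin n × Fin n) → Graph n
  selectEdges G S = graphFrom (λ a b → Adj G a b × Selected S a b) (selectEdge? G S)
    (λ (e , sel) → adj-sym G e , swap sel)
    (adj-irrefl G ∘ proj₁)

  selectEdges⁻ : ∀ (G : Graph n) S {a b} → Adj (selectEdges G S) a b → Adj G a b × Selected S a b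
  selectEdges⁻ G S {a} {b} = does-true⇒ (selectEdge? G S a b)

  selectEdges⁺ : ∀ (G : Graph n) S {a b} → Adj G a b × Selected S a b → Adj (selectEdges G S) a b
  selectEdges⁺ G S {a} {b} = dec-true (selectEdge? G S a b)

  selectEdges-subgraph : ∀ (G : Graph n) S → Subgraph (selectEdges G S) G
  selectEdges-subgraph G S a b e = proj₁ (selectEdges⁻ G S e)

  selectEdges-[] : ∀ G a b → ¬ Adj (selectEdges G []) a b
  selectEdges-[] G a b e with selectEdges⁻ G [] e
  ... | _ , inj₁ ()
  ... | _ , inj₂ ()

  pairs : List (Fin n) → List (Fin n) → List (Fin n × Fin n)
  pairs [] ys = []
  pairs (x ∷ xs) ys = map (x ,_) ys ++ pairs xs ys

  mem-pairs : ∀ xs ys {a b} → Mem a xs → Mem b ys → Mem (a , b) (pairs xs ys)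
  mem-pairs (x ∷ xs) ys (inj₁ refl) mb = mem-++ˡ (map (x ,_) ys) _ (mem-map (x ,_) ys mb)
  mem-pairs (x ∷ xs) ys (inj₂ ma) mb = mem-++ʳ (map (x ,_) ys) _ (mem-pairs xs ys ma mb)

  vertexPairs : List (Fin n × Fin n)
  vertexPairs = pairs (allFin n) (allFin n)

  mem-vertexPairs : ∀ a b → Mem (a , b) vertexPairs
  mem-vertexPairs a b = mem-pairs (allFin n) (allFin n) (mem-allFin a) (mem-allFin b)

  edgeList : Graph n → List (Fin n × Fin n)
  edgeList H = filterBy (λ (a , b) → adj H a b) vertexPairs

  selectEdges-edgeList⁺ : ∀ (G H : Graph n) → Subgraph H G → Subgraph H (selectEdges G (edgeList H))
  selectEdges-edgeList⁺ G H H⊆G a b e =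
    selectEdges⁺ G (edgeList H) (H⊆G a b e , inj₁ (filterBy-mem⁺ _ vertexPairs e (mem-vertexPairs a b)))

  selectEdges-edgeList⁻ : ∀ (G H : Graph n) → Subgraph (selectEdges G (edgeList H)) H
  selectEdges-edgeList⁻ G H a b e with selectEdges⁻ G (edgeList H) e
  ... | _ , inj₁ m = proj₁ (filterBy-mem⁻ _ vertexPairs m)
  ... | _ , inj₂ m = adj-sym H (proj₁ (filterBy-mem⁻ _ vertexPairs m))

-- Deciding the cactus property

module _ {n : ℕ} where

  consAll : List (Fin n) → List (List (Fin n)) → List (List (Fin n))
  consAll [] Ls = []
  consAll (x ∷ xs) Ls = map (x ∷_) Ls ++ consAll xs Ls

  consAll-mem : ∀ xs Ls {x r} → Mem x xs → Mem r Ls → Mem (x ∷ r) (consAll xs Ls)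
  consAll-mem (y ∷ xs) Ls (inj₁ refl) mr = mem-++ˡ (map (y ∷_) Ls) _ (mem-map (y ∷_) Ls mr)
  consAll-mem (y ∷ xs) Ls (inj₂ mx) mr = mem-++ʳ (map (y ∷_) Ls) _ (consAll-mem xs Ls mx mr)

  listsUpTo : ℕ → List (List (Fin n))
  listsUpTo zero = [] ∷ []
  listsUpTo (suc L) = [] ∷ consAll (allFin n) (listsUpTo L)

  mem-listsUpTo : ∀ L (xs : List (Fin n)) → length xs ≤ L → Mem xs (listsUpTo L)
  mem-listsUpTo zero [] le = inj₁ refl
  mem-listsUpTo (suc L) [] le = inj₁ refl
  mem-listsUpTo (suc L) (x ∷ xs) (s≤s le) =
    inj₂ (consAll-mem (allFin n) (listsUpTo L) (mem-allFin x) (mem-listsUpTo L xs le))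

  shortLists : List (List (Fin n))
  shortLists = listsUpTo n

  distinct-length≤ : ∀ (xs : List (Fin n)) → Distinct xs → length xs ≤ n
  distinct-length≤ xs d = injective⇒≤ (lookup-injective xs d)

  mem-shortLists : ∀ xs → Distinct xs → Mem xs shortLists
  mem-shortLists xs d = mem-listsUpTo n xs (distinct-length≤ xs d)

  disjointOrEqual? : ∀ (K : Graph n) xs ys → Dec (DisjointOrEqual K xs ys)
  disjointOrEqual? K xs ys =
    isCycle? K xs →-dec isCycle? K ys →-dec
    all? λ u → all? λ v → cyclicEdge? xs u v →-dec cyclicEdge? ys u v →-dec
    all? λ a → all? λ b → cyclicEdge? xs a b →-dec cyclicEdge? ys a b

  -- Cycle lists are duplicate-free, so only the finitely many lists of length ≤ n need checking.
  cactusCycles? : ∀ (K : Graph n) → Dec (CactusCycles K)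
  cactusCycles? K = map′ to from (allMem? shortLists λ xs → allMem? shortLists λ ys → disjointOrEqual? K xs ys)
    where
    to : (∀ xs → Mem xs shortLists → ∀ ys → Mem ys shortLists → DisjointOrEqual K xs ys) → CactusCycles K
    to h xs ys lx ly = h xs (mem-shortLists xs (proj₁ lx)) ys (mem-shortLists ys (proj₁ ly)) lx ly
    from : CactusCycles K → ∀ xs → Mem xs shortLists → ∀ ys → Mem ys shortLists → DisjointOrEqual K xs ys
    from c xs _ ys _ = c xs ys

-- Ears of long cycles in chordal graphs

¬→⇒×¬ : ∀ {A B : Set} → Dec A → Dec B → ¬ (A → B) → A × ¬ B
¬→⇒×¬ (yes a) (yes b) h = ⊥-elim (h (λ _ → b))
¬→⇒×¬ (yes a) (no nb) h = a , nb
¬→⇒×¬ (no na) _ h = ⊥-elim (h (λ a → ⊥-elim (na a)))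

¬∀∀⟶∃∃¬ : ∀ {k} (R : Fin k → Fin k → Set) → (∀ i j → Dec (R i j)) → ¬ (∀ i j → R i j) →
  ∃₂ λ i j → ¬ R i j
¬∀∀⟶∃∃¬ R R? ¬∀ with ¬∀⟶∃¬ _ _ (λ i → all? (R? i)) ¬∀
... | i , ¬∀j with ¬∀⟶∃¬ _ _ (R? i) ¬∀j
... | j , ¬Rij = i , j , ¬Rij

module _ {A : Set} where

  length-∷ʳ-≥1 : ∀ (p : List A) b → 1 ≤ length (p ++ [ b ])
  length-∷ʳ-≥1 [] b = s≤s z≤n
  length-∷ʳ-≥1 (x ∷ p) b = s≤s z≤n

  length-∷ʳ-≤ : ∀ (u s : List A) b w → length (s ++ [ b ]) ≤ length (u ++ s ++ b ∷ w)
  length-∷ʳ-≤ [] [] b w = s≤s z≤n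
  length-∷ʳ-≤ [] (x ∷ s) b w = s≤s (length-∷ʳ-≤ [] s b w)
  length-∷ʳ-≤ (x ∷ u) s b w = ≤-trans (length-∷ʳ-≤ u s b w) (n≤1+n _)

  length-∷ʳ-< : ∀ (s : List A) b x w → length (s ++ [ b ]) < length (s ++ b ∷ x ∷ w)
  length-∷ʳ-< [] b x w = s≤s (s≤s z≤n)
  length-∷ʳ-< (y ∷ s) b x w = s≤s (length-∷ʳ-< s b x w)

  arc-split : ∀ (u : List A) a s b w → u ++ a ∷ s ++ b ∷ w ≡ u ++ (a ∷ s ++ [ b ]) ++ w
  arc-split u a s b w = cong (λ z → u ++ a ∷ z) (sym (++-assoc s [ b ] w))

module _ {n : ℕ} where

  cyclicStep-mem : ∀ (xs : List (Fin n)) {a b} → CyclicStep xs a b → Mem a xs × Mem b xs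
  cyclicStep-mem xs (inj₁ c) = step-mem xs c
  cyclicStep-mem xs (inj₂ (q , refl)) = inj₂ (mem-++ʳ q [ _ ] (inj₁ refl)) , inj₁ refl

  Chord : Graph n → List (Fin n) → Set
  Chord G xs = ∃₂ λ a b → Mem a xs × Mem b xs × Adj G a b × ¬ CyclicEdge xs a b

  induced-violation⇒chord : ∀ (G : Graph n) xs {m} (C : Cycle G m) →
    (∀ a b → CycleEdge C a b → CyclicEdge xs a b) → (∀ a b → CyclicEdge xs a b → CycleEdge C a b) →
    ∀ i j → Adj G (vert C i) (vert C j) → ¬ ((j ≡ next i) ⊎ (i ≡ next j)) → Chord G xs
  induced-violation⇒chord G xs C to from i j ij ¬consecutive =
    vert C i , vert C j , on-cycle i , on-cycle j , ij , ¬edge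
    where
    on-cycle : ∀ k → Mem (vert C k) xs
    on-cycle k with to _ _ (k , inj₁ (refl , refl))
    ... | inj₁ c = proj₁ (cyclicStep-mem xs c)
    ... | inj₂ c = proj₂ (cyclicStep-mem xs c)
    ¬edge : ¬ CyclicEdge xs (vert C i) (vert C j)
    ¬edge e with from _ _ e
    ... | t , inj₁ (e1 , e2) with inj C e1
    ...   | refl = ¬consecutive (inj₁ (sym (inj C e2)))
    ¬edge e | t , inj₂ (e1 , e2) with inj C e1
    ...   | refl = ¬consecutive (inj₂ (sym (inj C e2)))

  long-cycle-chord : ∀ (G : Graph n) → Chordal G → ∀ xs → IsCycle G xs → 4 ≤ length xs → Chord G xs
  long-cycle-chord G chordal xs cyc 4≤length with isCycle⇒cycle xs cyc
  ... | m , length≡ , C , to , from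
    with ¬∀∀⟶∃∃¬ (λ i j → Adj G (vert C i) (vert C j) → (j ≡ next i) ⊎ (i ≡ next j))
                 (λ i j → adj? G _ _ →-dec ((j ≟ next i) ⊎-dec (i ≟ next j)))
                 (chordal m (s≤s⁻¹ (s≤s⁻¹ (s≤s⁻¹ (subst (4 ≤_) length≡ 4≤length)))) C)
  ... | i , j , ¬induced with ¬→⇒×¬ (adj? G _ _) ((j ≟ next i) ⊎-dec (i ≟ next j)) ¬induced
  ... | ij , ¬consecutive = induced-violation⇒chord G xs C to from i j ij ¬consecutive

  Ear : Graph n → List (Fin n) → Set
  Ear G xs = Σ (List (Fin n)) λ u → Σ (Fin n) λ c0 → Σ (Fin n) λ c1 → Σ (Fin n) λ c2 →
    Σ (List (Fin n)) λ w → (xs ≡ u ++ c0 ∷ c1 ∷ c2 ∷ w) × Adj G c0 c2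

  ear-infix : ∀ {G : Graph n} u ys w → Ear G ys → Ear G (u ++ ys ++ w)
  ear-infix u ys w (u′ , c0 , c1 , c2 , w′ , refl , c0c2) =
    u ++ u′ , c0 , c1 , c2 , w′ ++ w ,
    trans (cong (u ++_) (++-assoc u′ (c0 ∷ c1 ∷ c2 ∷ w′) w)) (sym (++-assoc u u′ _)) , c0c2

  isCycle-arc : ∀ {G : Graph n} u a c s b w → IsCycle G (u ++ a ∷ (c ∷ s) ++ b ∷ w) → Adj G a b →
    IsCycle G (a ∷ (c ∷ s) ++ [ b ])
  isCycle-arc {G} u a c s b w (distinct , _ , steps) ab =
    distinct-infix u arc w (subst Distinct split distinct) ,
    s≤s (s≤s (length-∷ʳ-≥1 s b)) ,
    λ x y step → arc-step (CyclicStep-closed a (c ∷ s) b step)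
    where
    arc = a ∷ (c ∷ s) ++ [ b ]
    split = arc-split u a (c ∷ s) b w
    arc-step : ∀ {x y} → Step arc x y ⊎ (x ≡ b × y ≡ a) → Adj G x y
    arc-step (inj₁ st) = steps _ _ (inj₁ (subst (λ z → Step z _ _) (sym split) (step-infix u arc w st)))
    arc-step (inj₂ (refl , refl)) = adj-sym G ab

  -- The arc of the cycle cut off by a chord is a shorter cycle; it still has a chord unless it
  -- is a triangle, which is then an ear.
  mutual
    chord⇒ear : ∀ (G : Graph n) → Chordal G → ∀ N xs → length xs ≤ N → IsCycle G xs → Chord G xs → Ear G xs
    chord⇒ear G ch N xs le cyc (a , b , ma , mb , ab , ¬edge) with mem-split xs ma
    ... | u₁ , r₁ , refl with mem-++⁻ u₁ (a ∷ r₁) mb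
    ...   | inj₂ (inj₁ refl) = ⊥-elim (adj-irrefl G ab)
    ...   | inj₂ (inj₂ m) with mem-split r₁ m
    ...     | p , w , refl = ordered-chord⇒ear G ch N u₁ a p b w le cyc ab ¬edge
    chord⇒ear G ch N xs le cyc (a , b , ma , mb , ab , ¬edge) | u₁ , r₁ , refl | inj₁ m with mem-split u₁ m
    ...     | u , p , refl = subst (Ear G) (sym eq)
      (ordered-chord⇒ear G ch N u b p a r₁ (subst (λ z → length z ≤ N) eq le) (subst (IsCycle G) eq cyc)
        (adj-sym G ab) (λ e → ¬edge (subst (λ z → CyclicEdge z a b) (sym eq) (CyclicEdge-sym e))))
      where
      eq : (u ++ b ∷ p) ++ a ∷ r₁ ≡ u ++ b ∷ p ++ a ∷ r₁
      eq = ++-assoc u (b ∷ p) (a ∷ r₁)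

    ordered-chord⇒ear : ∀ (G : Graph n) → Chordal G → ∀ N u a p b w → length (u ++ a ∷ p ++ b ∷ w) ≤ N →
      IsCycle G (u ++ a ∷ p ++ b ∷ w) → Adj G a b → ¬ CyclicEdge (u ++ a ∷ p ++ b ∷ w) a b →
      Ear G (u ++ a ∷ p ++ b ∷ w)
    ordered-chord⇒ear G ch N u a [] b w le cyc ab ¬edge = ⊥-elim (¬edge (inj₁ (inj₁ (split⇒step u w))))
    ordered-chord⇒ear G ch N u a (c ∷ []) b w le cyc ab ¬edge = u , a , c , b , w , refl , ab
    ordered-chord⇒ear G ch N [] a (c ∷ d ∷ p) b [] le cyc ab ¬edge =
      ⊥-elim (¬edge (inj₂ (inj₂ (c ∷ d ∷ p , refl))))
    ordered-chord⇒ear G ch zero (x ∷ u) a (c ∷ d ∷ p) b w () cyc ab _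
    ordered-chord⇒ear G ch (suc N) (x ∷ u) a (c ∷ d ∷ p) b w le cyc ab _ =
      arc⇒ear G ch N (x ∷ u) a c d p b w (≤-trans (length-∷ʳ-≤ u (a ∷ c ∷ d ∷ p) b w) (s≤s⁻¹ le)) cyc ab
    ordered-chord⇒ear G ch zero [] a (c ∷ d ∷ p) b (x ∷ w) () cyc ab _
    ordered-chord⇒ear G ch (suc N) [] a (c ∷ d ∷ p) b (x ∷ w) le cyc ab _ =
      arc⇒ear G ch N [] a c d p b (x ∷ w) (s≤s⁻¹ (≤-trans (length-∷ʳ-< (a ∷ c ∷ d ∷ p) b x w) le)) cyc ab

    arc⇒ear : ∀ (G : Graph n) → Chordal G → ∀ N u a c d p b w → length (a ∷ c ∷ d ∷ p ++ [ b ]) ≤ N →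
      IsCycle G (u ++ a ∷ (c ∷ d ∷ p) ++ b ∷ w) → Adj G a b → Ear G (u ++ a ∷ (c ∷ d ∷ p) ++ b ∷ w)
    arc⇒ear G ch N u a c d p b w le cyc ab =
      subst (Ear G) (sym (arc-split u a (c ∷ d ∷ p) b w))
        (ear-infix {G = G} u _ w (chord⇒ear G ch N _ le arc
          (long-cycle-chord G ch _ arc (s≤s (s≤s (s≤s (length-∷ʳ-≥1 p b)))))))
      where
      arc : IsCycle G (a ∷ c ∷ d ∷ p ++ [ b ])
      arc = isCycle-arc {G = G} u a c (d ∷ p) b w cyc ab

  long-cycle-ear : ∀ (G : Graph n) → Chordal G → ∀ xs → IsCycle G xs → 4 ≤ length xs → Ear G xs
  long-cycle-ear G ch xs cyc 4≤length =
    chord⇒ear G ch (length xs) xs ≤-refl cyc (long-cycle-chord G ch xs cyc 4≤length)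

module _ {n : ℕ} where

  data TriangleEdge (x y z : Fin n) : Fin n → Fin n → Set where
    edge₀₁ : TriangleEdge x y z x y
    edge₁₀ : TriangleEdge x y z y x
    edge₁₂ : TriangleEdge x y z y z
    edge₂₁ : TriangleEdge x y z z y
    edge₀₂ : TriangleEdge x y z x z
    edge₂₀ : TriangleEdge x y z z x

  cyclicStep-triangle⁻ : ∀ {x y z p q : Fin n} → CyclicStep (x ∷ y ∷ z ∷ []) p q → TriangleEdge x y z p q
  cyclicStep-triangle⁻ (inj₁ (inj₁ (refl , refl))) = edge₀₁
  cyclicStep-triangle⁻ (inj₁ (inj₂ (inj₁ (refl , refl)))) = edge₁₂
  cyclicStep-triangle⁻ (inj₂ ([] , ()))
  cyclicStep-triangle⁻ (inj₂ (_ ∷ [] , refl)) = edge₂₀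
  cyclicStep-triangle⁻ (inj₂ (_ ∷ _ ∷ [] , ()))
  cyclicStep-triangle⁻ (inj₂ (_ ∷ _ ∷ _ ∷ _ , ()))

  TriangleEdge-flip : ∀ {x y z p q : Fin n} → TriangleEdge x y z p q → TriangleEdge x y z q p
  TriangleEdge-flip edge₀₁ = edge₁₀
  TriangleEdge-flip edge₁₀ = edge₀₁
  TriangleEdge-flip edge₁₂ = edge₂₁
  TriangleEdge-flip edge₂₁ = edge₁₂
  TriangleEdge-flip edge₀₂ = edge₂₀
  TriangleEdge-flip edge₂₀ = edge₀₂

  TriangleEdge-reverse : ∀ {x y z p q : Fin n} → TriangleEdge x y z p q → TriangleEdge z y x p q
  TriangleEdge-reverse edge₀₁ = edge₂₁
  TriangleEdge-reverse edge₁₀ = edge₁₂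
  TriangleEdge-reverse edge₁₂ = edge₁₀
  TriangleEdge-reverse edge₂₁ = edge₀₁
  TriangleEdge-reverse edge₀₂ = edge₂₀
  TriangleEdge-reverse edge₂₀ = edge₀₂

  cyclicEdge-triangle⁻ : ∀ {x y z p q : Fin n} → CyclicEdge (x ∷ y ∷ z ∷ []) p q → TriangleEdge x y z p q
  cyclicEdge-triangle⁻ (inj₁ c) = cyclicStep-triangle⁻ c
  cyclicEdge-triangle⁻ (inj₂ c) = TriangleEdge-flip (cyclicStep-triangle⁻ c)

  cyclicEdge-triangle⁺ : ∀ {x y z p q : Fin n} → TriangleEdge x y z p q → CyclicEdge (x ∷ y ∷ z ∷ []) p q
  cyclicEdge-triangle⁺ edge₀₁ = inj₁ (inj₁ (inj₁ (refl , refl)))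
  cyclicEdge-triangle⁺ edge₁₀ = inj₂ (inj₁ (inj₁ (refl , refl)))
  cyclicEdge-triangle⁺ edge₁₂ = inj₁ (inj₁ (inj₂ (inj₁ (refl , refl))))
  cyclicEdge-triangle⁺ edge₂₁ = inj₂ (inj₁ (inj₂ (inj₁ (refl , refl))))
  cyclicEdge-triangle⁺ edge₀₂ = inj₂ (inj₂ (_ ∷ [] , refl))
  cyclicEdge-triangle⁺ edge₂₀ = inj₁ (inj₂ (_ ∷ [] , refl))

  triangleEdge⇒adj : ∀ (K : Graph n) {x y z p q} → Adj K x y → Adj K y z → Adj K z x →
    TriangleEdge x y z p q → Adj K p q
  triangleEdge⇒adj K x~y y~z z~x edge₀₁ = x~y
  triangleEdge⇒adj K x~y y~z z~x edge₁₀ = adj-sym K x~y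
  triangleEdge⇒adj K x~y y~z z~x edge₁₂ = y~z
  triangleEdge⇒adj K x~y y~z z~x edge₂₁ = adj-sym K y~z
  triangleEdge⇒adj K x~y y~z z~x edge₀₂ = adj-sym K z~x
  triangleEdge⇒adj K x~y y~z z~x edge₂₀ = z~x

  triangle-isCycle : ∀ (K : Graph n) {x y z} → Adj K x y → Adj K y z → Adj K z x → IsCycle K (x ∷ y ∷ z ∷ [])
  triangle-isCycle K x~y y~z z~x =
    ((λ { (inj₁ refl) → adj-irrefl K x~y ; (inj₂ (inj₁ refl)) → adj-irrefl K z~x }) ,
     (λ { (inj₁ refl) → adj-irrefl K y~z }) , (λ ()) , _) ,
    s≤s (s≤s (s≤s z≤n)) ,
    λ p q c → triangleEdge⇒adj K x~y y~z z~x (cyclicStep-triangle⁻ c)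

  triangle-edges-meet : ∀ {x y z p q r s : Fin n} → TriangleEdge x y z p q → TriangleEdge x y z r s →
    p ≢ r → p ≢ s → q ≢ r → q ≢ s → ⊥
  triangle-edges-meet edge₀₁ edge₀₁ p≢r p≢s q≢r q≢s = p≢r refl
  triangle-edges-meet edge₀₁ edge₁₀ p≢r p≢s q≢r q≢s = p≢s refl
  triangle-edges-meet edge₀₁ edge₁₂ p≢r p≢s q≢r q≢s = q≢r refl
  triangle-edges-meet edge₀₁ edge₂₁ p≢r p≢s q≢r q≢s = q≢s refl
  triangle-edges-meet edge₀₁ edge₀₂ p≢r p≢s q≢r q≢s = p≢r refl
  triangle-edges-meet edge₀₁ edge₂₀ p≢r p≢s q≢r q≢s = p≢s refl
  triangle-edges-meet edge₁₀ edge₀₁ p≢r p≢s q≢r q≢s = p≢s refl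
  triangle-edges-meet edge₁₀ edge₁₀ p≢r p≢s q≢r q≢s = p≢r refl
  triangle-edges-meet edge₁₀ edge₁₂ p≢r p≢s q≢r q≢s = p≢r refl
  triangle-edges-meet edge₁₀ edge₂₁ p≢r p≢s q≢r q≢s = p≢s refl
  triangle-edges-meet edge₁₀ edge₀₂ p≢r p≢s q≢r q≢s = q≢r refl
  triangle-edges-meet edge₁₀ edge₂₀ p≢r p≢s q≢r q≢s = q≢s refl
  triangle-edges-meet edge₁₂ edge₀₁ p≢r p≢s q≢r q≢s = p≢s refl
  triangle-edges-meet edge₁₂ edge₁₀ p≢r p≢s q≢r q≢s = p≢r refl
  triangle-edges-meet edge₁₂ edge₁₂ p≢r p≢s q≢r q≢s = p≢r refl
  triangle-edges-meet edge₁₂ edge₂₁ p≢r p≢s q≢r q≢s = p≢s refl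
  triangle-edges-meet edge₁₂ edge₀₂ p≢r p≢s q≢r q≢s = q≢s refl
  triangle-edges-meet edge₁₂ edge₂₀ p≢r p≢s q≢r q≢s = q≢r refl
  triangle-edges-meet edge₂₁ edge₀₁ p≢r p≢s q≢r q≢s = q≢s refl
  triangle-edges-meet edge₂₁ edge₁₀ p≢r p≢s q≢r q≢s = q≢r refl
  triangle-edges-meet edge₂₁ edge₁₂ p≢r p≢s q≢r q≢s = p≢s refl
  triangle-edges-meet edge₂₁ edge₂₁ p≢r p≢s q≢r q≢s = p≢r refl
  triangle-edges-meet edge₂₁ edge₀₂ p≢r p≢s q≢r q≢s = p≢s refl
  triangle-edges-meet edge₂₁ edge₂₀ p≢r p≢s q≢r q≢s = p≢r refl
  triangle-edges-meet edge₀₂ edge₀₁ p≢r p≢s q≢r q≢s = p≢r refl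
  triangle-edges-meet edge₀₂ edge₁₀ p≢r p≢s q≢r q≢s = p≢s refl
  triangle-edges-meet edge₀₂ edge₁₂ p≢r p≢s q≢r q≢s = q≢s refl
  triangle-edges-meet edge₀₂ edge₂₁ p≢r p≢s q≢r q≢s = q≢r refl
  triangle-edges-meet edge₀₂ edge₀₂ p≢r p≢s q≢r q≢s = p≢r refl
  triangle-edges-meet edge₀₂ edge₂₀ p≢r p≢s q≢r q≢s = p≢s refl
  triangle-edges-meet edge₂₀ edge₀₁ p≢r p≢s q≢r q≢s = q≢r refl
  triangle-edges-meet edge₂₀ edge₁₀ p≢r p≢s q≢r q≢s = q≢s refl
  triangle-edges-meet edge₂₀ edge₁₂ p≢r p≢s q≢r q≢s = p≢s refl
  triangle-edges-meet edge₂₀ edge₂₁ p≢r p≢s q≢r q≢s = p≢r refl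
  triangle-edges-meet edge₂₀ edge₀₂ p≢r p≢s q≢r q≢s = p≢s refl
  triangle-edges-meet edge₂₀ edge₂₀ p≢r p≢s q≢r q≢s = p≢r refl


module _ {n : ℕ} where

  isCycle-rotate : ∀ (K : Graph n) u v → IsCycle K (u ++ v) → IsCycle K (v ++ u)
  isCycle-rotate K u v (d , l , steps) =
    distinct-++-comm u v d , subst (3 ≤_) (length-++-comm u v) l , (λ a b c → steps a b (CyclicStep-rotate v u c))

  SameEdges : List (Fin n) → List (Fin n) → Set
  SameEdges xs ys = (∀ a b → CyclicEdge xs a b → CyclicEdge ys a b) × (∀ a b → CyclicEdge ys a b → CyclicEdge xs a b)

  Rotation : Graph n → List (Fin n) → Fin n → Fin n → Set
  Rotation K ds x z = Σ (List (Fin n)) λ P → IsCycle K (z ∷ P ++ [ x ]) × SameEdges (z ∷ P ++ [ x ]) ds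

  rotate-to : ∀ (K : Graph n) ds {x z} → IsCycle K ds → CyclicStep ds x z → Rotation K ds x z
  rotate-to K ds cyc (inj₂ (Q , refl)) = Q , cyc , (λ a b e → e) , (λ a b e → e)
  rotate-to K ds {x} {z} cyc (inj₁ c) with step⇒split ds c
  ... | p , q , refl =
    q ++ p , subst (IsCycle K) eq₂ (isCycle-rotate K u v (subst (IsCycle K) eq₁ cyc)) ,
    (λ a b e → subst (λ t → CyclicEdge t a b) (sym eq₁) (CyclicEdge-rotate v u (subst (λ t → CyclicEdge t a b) (sym eq₂) e))) ,
    (λ a b e → subst (λ t → CyclicEdge t a b) eq₂ (CyclicEdge-rotate u v (subst (λ t → CyclicEdge t a b) eq₁ e)))
    where
    u = p ++ [ x ]
    v = z ∷ q
    eq₁ : p ++ x ∷ z ∷ q ≡ u ++ v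
    eq₁ = sym (++-assoc p [ x ] (z ∷ q))
    eq₂ : v ++ u ≡ z ∷ (q ++ p) ++ [ x ]
    eq₂ = cong (z ∷_) (sym (++-assoc q p [ x ]))

  closing-step⇒[] : ∀ {x z : Fin n} P {a b} → Distinct (z ∷ P ++ [ x ]) → Step (z ∷ P ++ [ x ]) a b →
    SamePair x z a b → P ≡ []
  closing-step⇒[] P d c (inj₁ (refl , refl)) = ⊥-elim (proj₁ d (step-mem-tail _ (P ++ [ _ ]) c))
  closing-step⇒[] [] d c (inj₂ (refl , refl)) = refl
  closing-step⇒[] (h ∷ P) d (inj₁ (_ , refl)) (inj₂ (refl , refl)) =
    ⊥-elim (proj₁ (proj₂ d) (mem-++ʳ P [ h ] (inj₁ refl)))
  closing-step⇒[] {x} (h ∷ P) d (inj₂ c) (inj₂ (refl , refl)) =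
    ⊥-elim (proj₁ d (proj₁ (step-mem (h ∷ P ++ [ x ]) c)))

  length≥3⇒nonempty : ∀ (x z : Fin n) P → 3 ≤ length (z ∷ P ++ [ x ]) → P ≢ []
  length≥3⇒nonempty x z [] (s≤s (s≤s ())) refl

  closing-pair-not-step : ∀ {x z : Fin n} {P a b} → Distinct (z ∷ P ++ [ x ]) → 3 ≤ length (z ∷ P ++ [ x ]) →
    Step (z ∷ P ++ [ x ]) a b → ¬ SamePair x z a b
  closing-pair-not-step {x} {z} {P} d l c pair = length≥3⇒nonempty x z P l (closing-step⇒[] P d c pair)

-- A cactus H ⊆ G containing the cycle c0 c1 c2 c3 … together with the G-edge c0c2: trading the
-- edge c2c3 for c0c2 keeps the number of edges, keeps H a cactus (the old cycle becomes the
-- triangle c0 c1 c2 plus a path) and creates the new triangle edges c0c1 and c1c2.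
module Exchange {n : ℕ} (G H : Graph n) (H⊆G : Subgraph H G) (ccl : CactusCycles H)
                (c0 c1 c2 c3 : Fin n) (r : List (Fin n)) (cyc : IsCycle H (c0 ∷ c1 ∷ c2 ∷ c3 ∷ r))
                (G-c0c2 : Adj G c0 c2) where

  cs : List (Fin n)
  cs = c0 ∷ c1 ∷ c2 ∷ c3 ∷ r

  c0≢c2 : c0 ≢ c2
  c0≢c2 e = proj₁ (proj₁ cyc) (inj₂ (inj₁ e))
  c0≢c3 : c0 ≢ c3
  c0≢c3 e = proj₁ (proj₁ cyc) (inj₂ (inj₂ (inj₁ e)))
  c1≢c2 : c1 ≢ c2
  c1≢c2 e = proj₁ (proj₂ (proj₁ cyc)) (inj₁ e)
  c1≢c3 : c1 ≢ c3
  c1≢c3 e = proj₁ (proj₂ (proj₁ cyc)) (inj₂ (inj₁ e))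
  c2≢c3 : c2 ≢ c3
  c2≢c3 e = proj₁ (proj₂ (proj₂ (proj₁ cyc))) (inj₁ e)

  e01 : CyclicEdge cs c0 c1
  e01 = inj₁ (inj₁ (inj₁ (refl , refl)))
  e12 : CyclicEdge cs c1 c2
  e12 = inj₁ (inj₁ (inj₂ (inj₁ (refl , refl))))
  e23 : CyclicEdge cs c2 c3
  e23 = inj₁ (inj₁ (inj₂ (inj₂ (inj₁ (refl , refl)))))

  H-c0c1 : Adj H c0 c1
  H-c0c1 = cyclicEdge⇒adj H cs (proj₂ (proj₂ cyc)) e01
  H-c1c2 : Adj H c1 c2
  H-c1c2 = cyclicEdge⇒adj H cs (proj₂ (proj₂ cyc)) e12

  -- Such a triangle would contain every edge of cs, in particular the disjoint edges c0c1 and c2c3.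
  triangle-avoids-cs : ∀ {x y z u v} → IsCycle H (x ∷ y ∷ z ∷ []) →
    CyclicEdge (x ∷ y ∷ z ∷ []) u v → CyclicEdge cs u v → ⊥
  triangle-avoids-cs tri uv uv′ = triangle-edges-meet (in-triangle e01) (in-triangle e23) c0≢c2 c0≢c3 c1≢c2 c1≢c3
    where
    in-triangle : ∀ {a b} → CyclicEdge cs a b → TriangleEdge _ _ _ a b
    in-triangle ab = cyclicEdge-triangle⁻ (ccl cs _ cyc tri _ _ uv′ uv _ _ ab)

  ¬H-c0c2 : ¬ Adj H c0 c2
  ¬H-c0c2 c0c2 = triangle-avoids-cs (triangle-isCycle H H-c0c1 H-c1c2 (adj-sym H c0c2))
    (cyclicEdge-triangle⁺ edge₀₁) e01

  D : Graph n
  D = removeEdge H c2 c3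

  H′ : Graph n
  H′ = addEdge D c0 c2 c0≢c2

  Kept : Fin n → Fin n → Set
  Kept a b = Adj H a b × ¬ SamePair c2 c3 a b

  H′-adj⁻ : ∀ {a b} → Adj H′ a b → Kept a b ⊎ SamePair c0 c2 a b
  H′-adj⁻ e = Sum.map₁ (removeEdge⁻ H c2 c3) (addEdge⁻ D c0 c2 c0≢c2 e)

  H′-adj⁺ : ∀ {a b} → Kept a b ⊎ SamePair c0 c2 a b → Adj H′ a b
  H′-adj⁺ e = addEdge⁺ D c0 c2 c0≢c2 (Sum.map₁ (removeEdge⁺ H c2 c3) e)

  H′⊆G : Subgraph H′ G
  H′⊆G a b e with H′-adj⁻ e
  ... | inj₁ (h , _) = H⊆G a b h
  ... | inj₂ (inj₁ (refl , refl)) = G-c0c2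
  ... | inj₂ (inj₂ (refl , refl)) = adj-sym G G-c0c2

  numEdges-H≤H′ : numEdges H ≤ numEdges H′
  numEdges-H≤H′ = ≤-trans (numEdges-≤-suc H D c2 c3 kept-or-removed)
    (numEdges-< D H′ (λ a b → addEdge⁺ D c0 c2 c0≢c2 ∘ inj₁) c0 c2
      (H′-adj⁺ (inj₂ (inj₁ (refl , refl)))) (¬H-c0c2 ∘ proj₁ ∘ removeEdge⁻ H c2 c3))
    where
    kept-or-removed : ∀ a b → Adj H a b → Adj D a b ⊎ SamePair c2 c3 a b
    kept-or-removed a b e with samePair? c2 c3 a b
    ... | yes removed = inj₂ removed
    ... | no kept = inj₁ (removeEdge⁺ H c2 c3 (e , kept))

  inTriangle-H⇒H′ : ∀ {a b} → InTriangle H a b → InTriangle H′ a b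
  inTriangle-H⇒H′ {a} {b} (ab , w , aw , wb) = kept ab edge₀₂ , w , kept aw edge₀₁ , kept wb edge₁₂
    where
    tri : IsCycle H (a ∷ w ∷ b ∷ [])
    tri = triangle-isCycle H aw wb (adj-sym H ab)
    kept : ∀ {p q} → Adj H p q → TriangleEdge a w b p q → Adj H′ p q
    kept h t = H′-adj⁺ (inj₁ (h , λ
      { (inj₁ (refl , refl)) → triangle-avoids-cs tri (cyclicEdge-triangle⁺ t) e23
      ; (inj₂ (refl , refl)) → triangle-avoids-cs tri (CyclicEdge-sym (cyclicEdge-triangle⁺ t)) e23 }))

  ¬c2c3 : ∀ {a b} → a ≢ c2 → a ≢ c3 → ¬ SamePair c2 c3 a b
  ¬c2c3 a≢c2 _ (inj₁ (a≡c2 , _)) = a≢c2 a≡c2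
  ¬c2c3 _ a≢c3 (inj₂ (a≡c3 , _)) = a≢c3 a≡c3

  c0c1-in-triangle′ : InTriangle H′ c0 c1
  c0c1-in-triangle′ =
    H′-adj⁺ (inj₁ (H-c0c1 , ¬c2c3 c0≢c2 c0≢c3)) , c2 ,
    H′-adj⁺ (inj₂ (inj₁ (refl , refl))) ,
    H′-adj⁺ (inj₁ (adj-sym H H-c1c2 , λ { (inj₁ (_ , c1≡c3)) → c1≢c3 c1≡c3 ; (inj₂ (c2≡c3 , _)) → c2≢c3 c2≡c3 }))

  c0c1-not-in-triangle : ¬ InTriangle H c0 c1
  c0c1-not-in-triangle (_ , w , c0w , wc1) =
    triangle-avoids-cs (triangle-isCycle H c0w wc1 (adj-sym H H-c0c1)) (cyclicEdge-triangle⁺ edge₀₂) e01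

  numTriangleEdges-H<H′ : suc (numTriangleEdges H) ≤ numTriangleEdges H′
  numTriangleEdges-H<H′ = numEdges-< (triangleEdges H) (triangleEdges H′)
    (λ a b e → triangleEdges⁺ H′ (inTriangle-H⇒H′ (triangleEdges⁻ H e))) c0 c1
    (triangleEdges⁺ H′ c0c1-in-triangle′) (c0c1-not-in-triangle ∘ triangleEdges⁻ H)

  step-c0c2⇒edge : ∀ {ds a b} → CyclicStep ds a b → SamePair c0 c2 a b → CyclicEdge ds c0 c2
  step-c0c2⇒edge c (inj₁ (refl , refl)) = inj₁ c
  step-c0c2⇒edge c (inj₂ (refl , refl)) = inj₂ c

  avoiding-c0c2⇒H-cycle : ∀ ds → ¬ CyclicEdge ds c0 c2 → IsCycle H′ ds → IsCycle H ds × ¬ CyclicEdge ds c2 c3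
  avoiding-c0c2⇒H-cycle ds ¬c0c2 (d , l , steps) = (d , l , λ a b c → in-H c (H′-adj⁻ (steps a b c))) , ¬c2c3-edge
    where
    in-H : ∀ {a b} → CyclicStep ds a b → Kept a b ⊎ SamePair c0 c2 a b → Adj H a b
    in-H c (inj₁ (h , _)) = h
    in-H c (inj₂ p) = ⊥-elim (¬c0c2 (step-c0c2⇒edge c p))
    ¬c2c3-edge : ¬ CyclicEdge ds c2 c3
    ¬c2c3-edge ce with H′-adj⁻ (cyclicEdge⇒adj H′ ds steps ce)
    ... | inj₁ (_ , ¬removed) = ¬removed (inj₁ (refl , refl))
    ... | inj₂ (inj₁ (c2≡c0 , _)) = c0≢c2 (sym c2≡c0)
    ... | inj₂ (inj₂ (_ , c3≡c0)) = c0≢c3 (sym c3≡c0)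

  -- The only cycle of H′ through the new edge xz is x y z: any other one would yield a cycle of H
  -- through xy or yz avoiding c2c3.
  module ClosingTriangle (x y z : Fin n) (kept-xy : Kept x y) (kept-yz : Kept y z)
      (forces-c2c3 : ∀ ys → IsCycle H ys → CyclicEdge ys x y ⊎ CyclicEdge ys y z → CyclicEdge ys c2 c3) where

    KeptPath : List (Fin n) → Set
    KeptPath P = ∀ a b → CyclicStep (z ∷ P ++ [ x ]) a b → ¬ SamePair x z a b → Kept a b

    kept-cycle-avoids : ∀ ys → Distinct ys → 3 ≤ length ys → (∀ a b → CyclicStep ys a b → Kept a b) →
      ¬ (CyclicEdge ys x y ⊎ CyclicEdge ys y z)
    kept-cycle-avoids ys d l kept e with forces-c2c3 ys (d , l , λ a b c → proj₁ (kept a b c)) e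
    ... | inj₁ c = proj₂ (kept c2 c3 c) (inj₁ (refl , refl))
    ... | inj₂ c = proj₂ (kept c3 c2 c) (inj₂ (refl , refl))

    y-absent : ∀ P → Distinct (z ∷ P ++ [ x ]) → 3 ≤ length (z ∷ P ++ [ x ]) → KeptPath P →
      ¬ Mem y (z ∷ P ++ [ x ]) → ⊥
    y-absent P d l kept y∉ = kept-cycle-avoids (y ∷ z ∷ P ++ [ x ]) (y∉ , d) (s≤s (s≤s (length-∷ʳ-≥1 P x))) kept′
      (inj₂ (inj₁ (inj₁ (inj₁ (refl , refl)))))
      where
      kept′ : ∀ a b → CyclicStep (y ∷ (z ∷ P) ++ [ x ]) a b → Kept a b
      kept′ a b c with CyclicStep-closed y (z ∷ P) x c
      ... | inj₁ (inj₁ (refl , refl)) = kept-yz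
      ... | inj₁ (inj₂ c′) = kept a b (inj₁ c′) (closing-pair-not-step d l c′)
      ... | inj₂ (refl , refl) = kept-xy

    y-first : ∀ p P → Distinct (z ∷ (y ∷ p ∷ P) ++ [ x ]) → KeptPath (y ∷ p ∷ P) → ⊥
    y-first p P d kept = kept-cycle-avoids (y ∷ (p ∷ P) ++ [ x ]) (proj₂ d) (s≤s (s≤s (length-∷ʳ-≥1 P x))) kept′
      (inj₁ (inj₁ (inj₂ (p ∷ P , refl))))
      where
      kept′ : ∀ a b → CyclicStep (y ∷ (p ∷ P) ++ [ x ]) a b → Kept a b
      kept′ a b c with CyclicStep-closed y (p ∷ P) x c
      ... | inj₁ c′ = kept a b (inj₁ (inj₂ c′)) λ
        { (inj₁ (_ , refl)) → proj₁ d (proj₂ (step-mem _ c′))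
        ; (inj₂ (refl , _)) → proj₁ d (proj₁ (step-mem _ c′)) }
      ... | inj₂ (refl , refl) = kept-xy

    y-later : ∀ p P₁ P₂ → Distinct (z ∷ ((p ∷ P₁) ++ y ∷ P₂) ++ [ x ]) → KeptPath ((p ∷ P₁) ++ y ∷ P₂) → ⊥
    y-later p P₁ P₂ d kept = kept-cycle-avoids ys (proj₁ parts) (s≤s (s≤s (length-∷ʳ-≥1 P₁ y))) kept′
      (inj₂ (inj₁ (inj₂ (p ∷ P₁ , refl))))
      where
      ys = z ∷ (p ∷ P₁) ++ [ y ]
      rest = P₂ ++ [ x ]
      split : z ∷ ((p ∷ P₁) ++ y ∷ P₂) ++ [ x ] ≡ ys ++ rest
      split = cong (z ∷_) (trans (++-assoc (p ∷ P₁) (y ∷ P₂) [ x ]) (sym (++-assoc (p ∷ P₁) [ y ] rest)))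
      parts = distinct-++⁻ ys rest (subst Distinct split d)
      x∉ys : ¬ Mem x ys
      x∉ys m = proj₂ (proj₂ parts) m (mem-++ʳ P₂ [ x ] (inj₁ refl))
      kept′ : ∀ a b → CyclicStep ys a b → Kept a b
      kept′ a b c with CyclicStep-closed z (p ∷ P₁) y c
      ... | inj₁ c′ = kept a b (inj₁ (subst (λ t → Step t a b) (sym split) (step-infix [] ys rest c′))) λ
        { (inj₁ (refl , _)) → x∉ys (proj₁ (step-mem _ c′))
        ; (inj₂ (_ , refl)) → x∉ys (proj₂ (step-mem _ c′)) }
      ... | inj₂ (refl , refl) = kept-yz

    closing-path≡y : ∀ P → Distinct (z ∷ P ++ [ x ]) → 3 ≤ length (z ∷ P ++ [ x ]) → KeptPath P → P ≡ [ y ]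
    closing-path≡y P d l kept with mem? _≟_ y (z ∷ P ++ [ x ])
    ... | no y∉ = ⊥-elim (y-absent P d l kept y∉)
    ... | yes (inj₁ y≡z) = ⊥-elim (adj-≢ H (proj₁ kept-yz) y≡z)
    ... | yes (inj₂ y∈) with mem-++⁻ P [ x ] y∈
    ...   | inj₂ (inj₁ y≡x) = ⊥-elim (adj-≢ H (proj₁ kept-xy) (sym y≡x))
    ...   | inj₁ y∈P with mem-split P y∈P
    ...     | [] , [] , P≡ = P≡
    ...     | [] , p ∷ P₂ , refl = ⊥-elim (y-first p P₂ d kept)
    ...     | p ∷ P₁ , P₂ , refl = ⊥-elim (y-later p P₁ P₂ d kept)

  ¬c2c3-c0c1 : ¬ SamePair c2 c3 c0 c1
  ¬c2c3-c0c1 = ¬c2c3 c0≢c2 c0≢c3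

  ¬c2c3-c1c2 : ¬ SamePair c2 c3 c1 c2
  ¬c2c3-c1c2 = ¬c2c3 c1≢c2 c1≢c3

  kept-c0c1 : Kept c0 c1
  kept-c0c1 = H-c0c1 , ¬c2c3-c0c1

  kept-c1c2 : Kept c1 c2
  kept-c1c2 = H-c1c2 , ¬c2c3-c1c2

  forces-c2c3 : ∀ ys → IsCycle H ys → CyclicEdge ys c0 c1 ⊎ CyclicEdge ys c1 c2 → CyclicEdge ys c2 c3
  forces-c2c3 ys cyc′ (inj₁ e) = ccl cs ys cyc cyc′ c0 c1 e01 e c2 c3 e23
  forces-c2c3 ys cyc′ (inj₂ e) = ccl cs ys cyc cyc′ c1 c2 e12 e c2 c3 e23

  SameEdgesAsTriangle : List (Fin n) → Set
  SameEdgesAsTriangle ds = (∀ a b → CyclicEdge ds a b → TriangleEdge c0 c1 c2 a b) ×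
                           (∀ a b → TriangleEdge c0 c1 c2 a b → CyclicEdge ds a b)

  Kept-sym : ∀ {a b} → Kept a b → Kept b a
  Kept-sym (h , ¬removed) = adj-sym H h , ¬removed ∘ SamePair-flip

  forces-c2c3-reversed : ∀ ys → IsCycle H ys → CyclicEdge ys c2 c1 ⊎ CyclicEdge ys c1 c0 → CyclicEdge ys c2 c3
  forces-c2c3-reversed ys cyc′ = forces-c2c3 ys cyc′ ∘ swap ∘ Sum.map CyclicEdge-sym CyclicEdge-sym

  rotation⇒triangle : ∀ ds {x z} → SamePair c0 c2 x z → Rotation H′ ds x z → SameEdgesAsTriangle ds
  rotation⇒triangle ds (inj₁ (refl , refl)) (P , cyc′ , from , to)
    with ClosingTriangle.closing-path≡y c0 c1 c2 kept-c0c1 kept-c1c2 forces-c2c3 P (proj₁ cyc′) (proj₁ (proj₂ cyc′))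
           (λ a b c ¬c0c2 → Sum.[ id , ⊥-elim ∘ ¬c0c2 ]′ (H′-adj⁻ (proj₂ (proj₂ cyc′) a b c)))
  ... | refl = (λ a b e → TriangleEdge-reverse (cyclicEdge-triangle⁻ (to a b e))) ,
               (λ a b t → from a b (cyclicEdge-triangle⁺ (TriangleEdge-reverse t)))
  rotation⇒triangle ds (inj₂ (refl , refl)) (P , cyc′ , from , to)
    with ClosingTriangle.closing-path≡y c2 c1 c0 (Kept-sym kept-c1c2) (Kept-sym kept-c0c1) forces-c2c3-reversed
           P (proj₁ cyc′) (proj₁ (proj₂ cyc′))
           (λ a b c ¬c2c0 → Sum.[ id , ⊥-elim ∘ ¬c2c0 ∘ SamePair-swap ]′ (H′-adj⁻ (proj₂ (proj₂ cyc′) a b c)))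
  ... | refl = (λ a b e → cyclicEdge-triangle⁻ (to a b e)) , (λ a b t → from a b (cyclicEdge-triangle⁺ t))

  through-c0c2⇒triangle : ∀ ds → CyclicEdge ds c0 c2 → IsCycle H′ ds → SameEdgesAsTriangle ds
  through-c0c2⇒triangle ds (inj₁ c) cyc′ = rotation⇒triangle ds (inj₁ (refl , refl)) (rotate-to H′ ds cyc′ c)
  through-c0c2⇒triangle ds (inj₂ c) cyc′ = rotation⇒triangle ds (inj₂ (refl , refl)) (rotate-to H′ ds cyc′ c)

  triangle-edge⇒old-or-new : ∀ {u v} → TriangleEdge c0 c1 c2 u v → CyclicEdge cs u v ⊎ SamePair c0 c2 u v
  triangle-edge⇒old-or-new edge₀₁ = inj₁ e01
  triangle-edge⇒old-or-new edge₁₀ = inj₁ (CyclicEdge-sym e01)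
  triangle-edge⇒old-or-new edge₁₂ = inj₁ e12
  triangle-edge⇒old-or-new edge₂₁ = inj₁ (CyclicEdge-sym e12)
  triangle-edge⇒old-or-new edge₀₂ = inj₂ (inj₁ (refl , refl))
  triangle-edge⇒old-or-new edge₂₀ = inj₂ (inj₂ (refl , refl))

  cycles-through-and-avoiding-c0c2-disjoint : ∀ ds₁ ds₂ → IsCycle H′ ds₁ → IsCycle H′ ds₂ →
    CyclicEdge ds₁ c0 c2 → ¬ CyclicEdge ds₂ c0 c2 → ∀ u v → CyclicEdge ds₁ u v → ¬ CyclicEdge ds₂ u v
  cycles-through-and-avoiding-c0c2-disjoint ds₁ ds₂ cyc₁ cyc₂ through avoiding u v uv₁ uv₂
    with triangle-edge⇒old-or-new (proj₁ (through-c0c2⇒triangle ds₁ through cyc₁) u v uv₁)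
  ... | inj₂ (inj₁ (refl , refl)) = avoiding uv₂
  ... | inj₂ (inj₂ (refl , refl)) = avoiding (CyclicEdge-sym uv₂)
  ... | inj₁ old = proj₂ (avoiding-c0c2⇒H-cycle ds₂ avoiding cyc₂)
                     (ccl cs ds₂ cyc (proj₁ (avoiding-c0c2⇒H-cycle ds₂ avoiding cyc₂)) u v old uv₂ c2 c3 e23)

  cactusCycles-H′ : CactusCycles H′
  cactusCycles-H′ ds₁ ds₂ cyc₁ cyc₂ u v uv₁ uv₂ a b ab
    with cyclicEdge? ds₁ c0 c2 | cyclicEdge? ds₂ c0 c2
  ... | yes t₁ | yes t₂ =
    proj₂ (through-c0c2⇒triangle ds₂ t₂ cyc₂) a b (proj₁ (through-c0c2⇒triangle ds₁ t₁ cyc₁) a b ab)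
  ... | yes t₁ | no n₂ = ⊥-elim (cycles-through-and-avoiding-c0c2-disjoint ds₁ ds₂ cyc₁ cyc₂ t₁ n₂ u v uv₁ uv₂)
  ... | no n₁ | yes t₂ = ⊥-elim (cycles-through-and-avoiding-c0c2-disjoint ds₂ ds₁ cyc₂ cyc₁ t₂ n₁ u v uv₂ uv₁)
  ... | no n₁ | no n₂ = ccl ds₁ ds₂ (proj₁ (avoiding-c0c2⇒H-cycle ds₁ n₁ cyc₁))
                          (proj₁ (avoiding-c0c2⇒H-cycle ds₂ n₂ cyc₂)) u v uv₁ uv₂ a b ab

module _ {n : ℕ} where

  numTriangleEdges<scoreBase : ∀ (K : Graph n) → numTriangleEdges K < scoreBase {n}
  numTriangleEdges<scoreBase K = s≤s (≤-trans (numTriangleEdges≤numEdges K) (numEdges≤n² K))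

  score-<-numEdges : ∀ (A B : Graph n) → numEdges A < numEdges B → score A < score B
  score-<-numEdges A B lt = begin-strict
    numEdges A * s + numTriangleEdges A  <⟨ +-monoʳ-< (numEdges A * s) (numTriangleEdges<scoreBase A) ⟩
    numEdges A * s + s                   ≡⟨ +-comm (numEdges A * s) s ⟩
    suc (numEdges A) * s                 ≤⟨ *-monoˡ-≤ s lt ⟩
    numEdges B * s                       ≤⟨ m≤m+n _ _ ⟩
    score B                              ∎
    where
    open ≤-Reasoning
    s = scoreBase {n}

  score-<-triangles : ∀ (A B : Graph n) → numEdges A ≤ numEdges B → numTriangleEdges A < numTriangleEdges B →
    score A < score B
  score-<-triangles A B le lt = +-mono-≤-< (*-monoˡ-≤ (scoreBase {n}) le) lt

  score-≤⇒numEdges-≤ : ∀ (A B : Graph n) → score A ≤ score B → numEdges A ≤ numEdges B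
  score-≤⇒numEdges-≤ A B le = ≮⇒≥ (λ lt → <⇒≱ (score-<-numEdges B A lt) le)

  Improvement : Graph n → Graph n → Set
  Improvement G H = Σ (Graph n) λ H′ → Subgraph H′ G × CactusCycles H′ ×
    numEdges H ≤ numEdges H′ × numTriangleEdges H < numTriangleEdges H′

  shortcut⇒improvement : ∀ (G H : Graph n) → Subgraph H G → CactusCycles H → ∀ c0 c1 c2 t →
    IsCycle H (c0 ∷ c1 ∷ c2 ∷ t) → 4 ≤ length (c0 ∷ c1 ∷ c2 ∷ t) → Adj G c0 c2 → Improvement G H
  shortcut⇒improvement G H H⊆G cH c0 c1 c2 (c3 ∷ r) cyc _ c0c2 =
    H′ , H′⊆G , cactusCycles-H′ , numEdges-H≤H′ , numTriangleEdges-H<H′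
    where open Exchange G H H⊆G cH c0 c1 c2 c3 r cyc c0c2
  shortcut⇒improvement G H H⊆G cH c0 c1 c2 [] cyc (s≤s (s≤s (s≤s ()))) c0c2

  ear⇒improvement : ∀ (G H : Graph n) → Subgraph H G → CactusCycles H → ∀ xs → IsCycle H xs →
    4 ≤ length xs → Ear G xs → Improvement G H
  ear⇒improvement G H H⊆G cH xs cyc 4≤length (u , c0 , c1 , c2 , w , refl , c0c2) =
    shortcut⇒improvement G H H⊆G cH c0 c1 c2 (w ++ u) (isCycle-rotate H u (c0 ∷ c1 ∷ c2 ∷ w) cyc)
      (subst (4 ≤_) (length-++-comm u (c0 ∷ c1 ∷ c2 ∷ w)) 4≤length) c0c2

  long-cycle⇒improvement : ∀ (G H : Graph n) → Subgraph H G → CactusCycles H → Chordal G → ∀ xs →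
    IsCycle H xs → 4 ≤ length xs → Improvement G H
  long-cycle⇒improvement G H H⊆G cH ch xs cyc 4≤length =
    ear⇒improvement G H H⊆G cH xs cyc 4≤length (long-cycle-ear G ch xs (isCycle-mono H G H⊆G xs cyc) 4≤length)

module _ {n : ℕ} where

  walk-++ : ∀ {K : Graph n} {u v w} → Walk K u v → Walk K v w → Walk K u w
  walk-++ here q = q
  walk-++ (step a p) q = step a (walk-++ p q)

  walk-reverse : ∀ {K : Graph n} {u v} → Walk K u v → Walk K v u
  walk-reverse here = here
  walk-reverse {K} (step a p) = walk-++ (walk-reverse p) (step (adj-sym K a) here)

  steps⇒walk : ∀ (K : Graph n) s P t → (∀ p q → Step (s ∷ P ++ [ t ]) p q → Adj K p q) → Walk K s t
  steps⇒walk K s [] t h = step (h s t (inj₁ (refl , refl))) here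
  steps⇒walk K s (x ∷ P) t h = step (h s x (inj₁ (refl , refl))) (steps⇒walk K x P t (λ p q c → h p q (inj₂ c)))

  SamePair-trans : ∀ {a b x z p q : Fin n} → SamePair a b x z → SamePair a b p q → SamePair x z p q
  SamePair-trans (inj₁ (refl , refl)) pq = pq
  SamePair-trans (inj₂ (refl , refl)) pq = SamePair-swap pq

  rotation⇒walk : ∀ (H : Graph n) a b (a≢b : a ≢ b) {ys x z} → SamePair a b x z →
    Rotation (addEdge H a b a≢b) ys x z → Walk H z x
  rotation⇒walk H a b a≢b xz (P , (d , l , steps) , _) = steps⇒walk H _ P _ λ p q c →
    Sum.[ id , (λ pq → ⊥-elim (closing-pair-not-step d l c (SamePair-trans xz pq))) ]′
      (addEdge⁻ H a b a≢b (steps p q (inj₁ c)))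

  cycle-through⇒walk : ∀ (H : Graph n) a b (a≢b : a ≢ b) ys → IsCycle (addEdge H a b a≢b) ys →
    CyclicEdge ys a b → Walk H a b
  cycle-through⇒walk H a b a≢b ys cyc (inj₁ c) =
    walk-reverse (rotation⇒walk H a b a≢b (inj₁ (refl , refl)) (rotate-to (addEdge H a b a≢b) ys cyc c))
  cycle-through⇒walk H a b a≢b ys cyc (inj₂ c) =
    rotation⇒walk H a b a≢b (inj₂ (refl , refl)) (rotate-to (addEdge H a b a≢b) ys cyc c)

  addEdge-cactusCycles : ∀ (H : Graph n) a b (ne : a ≢ b) → CactusCycles H →
    (∀ ys → IsCycle (addEdge H a b ne) ys → ¬ CyclicEdge ys a b) → CactusCycles (addEdge H a b ne)
  addEdge-cactusCycles H a b ne ccl noc xs ys lx ly = ccl xs ys (toH xs lx) (toH ys ly)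
    where
    toH : ∀ zs → IsCycle (addEdge H a b ne) zs → IsCycle H zs
    toH zs (d , l , ac) = d , l , λ p q c → f c (addEdge⁻ H a b ne (ac p q c))
      where
      f : ∀ {p q} → CyclicStep zs p q → Adj H p q ⊎ SamePair a b p q → Adj H p q
      f c (inj₁ h) = h
      f c (inj₂ (inj₁ (refl , refl))) = ⊥-elim (noc zs (d , l , ac) (inj₁ c))
      f c (inj₂ (inj₂ (refl , refl))) = ⊥-elim (noc zs (d , l , ac) (inj₂ c))

  edgeless-cactusCycles : ∀ (K : Graph n) → (∀ a b → ¬ Adj K a b) → CactusCycles K
  edgeless-cactusCycles K no-edge (x₁ ∷ x₂ ∷ r) ys (_ , _ , steps) =
    ⊥-elim (no-edge x₁ x₂ (steps x₁ x₂ (inj₁ (inj₁ (refl , refl)))))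
  edgeless-cactusCycles K no-edge [] ys (_ , () , _)
  edgeless-cactusCycles K no-edge (_ ∷ []) ys (_ , s≤s () , _)

-- Optimal cacti

module _ {n : ℕ} (G : Graph n) where

  Optimal : Graph n → Set
  Optimal H = Subgraph H G × CactusCycles H ×
    (∀ (K : Graph n) → Subgraph K G → CactusCycles K → score K ≤ score H)

  optimal-exists : Σ (Graph n) Optimal
  optimal-exists with maximise (sublists vertexPairs) (CactusCycles ∘ selectEdges G)
                                (cactusCycles? ∘ selectEdges G) (score ∘ selectEdges G) []
                                (edgeless-cactusCycles (selectEdges G []) (selectEdges-[] G))
  ... | S , cS , _ , best = selectEdges G S , selectEdges-subgraph G S , cS , dominates
    where
    dominates : ∀ (K : Graph n) → Subgraph K G → CactusCycles K → score K ≤ score (selectEdges G S)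
    dominates K K⊆G cK =
      subst (_≤ score (selectEdges G S))
        (score-cong (selectEdges G (edgeList K)) K (selectEdges-edgeList⁻ G K) (selectEdges-edgeList⁺ G K K⊆G))
        (best (edgeList K) (filterBy-sublists _ vertexPairs)
          (cactusCycles-antimono K (selectEdges G (edgeList K)) (selectEdges-edgeList⁻ G K) cK))

  module _ {H : Graph n} (opt : Optimal H) where

    private
      H⊆G : Subgraph H G
      H⊆G = proj₁ opt
      cH : CactusCycles H
      cH = proj₁ (proj₂ opt)
      best : ∀ (K : Graph n) → Subgraph K G → CactusCycles K → score K ≤ score H
      best = proj₂ (proj₂ opt)

    optimal-maximum : ∀ (K : Graph n) → Subgraph K G → CactusCycles K → numEdges K ≤ numEdges H
    optimal-maximum K K⊆G cK = score-≤⇒numEdges-≤ K H (best K K⊆G cK)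

    -- Otherwise H + ab would be a cactus subgraph of G with more edges than H.
    optimal-nonedge⇒cycle : ∀ a b (ab : Adj G a b) → ¬ Adj H a b →
      ∃ λ ys → IsCycle (addEdge H a b (adj-≢ G ab)) ys × CyclicEdge ys a b
    optimal-nonedge⇒cycle a b ab ¬h
      with anyMem? shortLists (λ ys → isCycle? (addEdge H a b (adj-≢ G ab)) ys ×-dec cyclicEdge? ys a b)
    ... | yes (ys , _ , through) = ys , through
    ... | no none = ⊥-elim (<⇒≱ more-edges (best H+ab (addEdge-subgraph H G (adj-≢ G ab) H⊆G ab) cH+ab))
      where
      H+ab = addEdge H a b (adj-≢ G ab)
      cH+ab : CactusCycles H+ab
      cH+ab = addEdge-cactusCycles H a b (adj-≢ G ab) cH
        (λ ys cycle through → none (ys , mem-shortLists ys (proj₁ cycle) , cycle , through))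
      more-edges : score H < score H+ab
      more-edges = score-<-numEdges H H+ab (numEdges-< H H+ab (λ x y → addEdge⁺ H a b (adj-≢ G ab) ∘ inj₁) a b
        (addEdge⁺ H a b (adj-≢ G ab) (inj₂ (inj₁ (refl , refl)))) ¬h)

    optimal-edge⇒walk : ∀ a b → Adj G a b → Walk H a b
    optimal-edge⇒walk a b ab with adj? H a b
    ... | yes h = step h here
    ... | no ¬h with optimal-nonedge⇒cycle a b ab ¬h
    ...   | ys , cycle , through = cycle-through⇒walk H a b (adj-≢ G ab) ys cycle through

    optimal-connected : Connected G → Connected H
    optimal-connected conn u v = lift (conn u v)
      where
      lift : ∀ {x y} → Walk G x y → Walk H x y
      lift here = here
      lift (step e w) = walk-++ (optimal-edge⇒walk _ _ e) (lift w)

    optimal-unimprovable : ¬ Improvement G H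
    optimal-unimprovable (H′ , H′⊆G , cH′ , edges≤ , triangles<) =
      <⇒≱ (score-<-triangles H H′ edges≤ triangles<) (best H′ H′⊆G cH′)

    optimal-triangles : Chordal G → AllCyclesTriangles H
    optimal-triangles chordal zero C = refl
    optimal-triangles chordal (suc m) C = ⊥-elim (optimal-unimprovable
      (long-cycle⇒improvement G H H⊆G cH chordal (tabulate (vert C)) (cycle⇒isCycle C) 4≤length))
      where
      4≤length : 4 ≤ length (tabulate (vert C))
      4≤length = subst (4 ≤_) (sym (length-tabulate (vert C))) (s≤s (s≤s (s≤s (s≤s z≤n))))

mainTheorem8 : ∀ {n} (G : Graph n) → Connected G → Chordal G →
    Σ (Graph n) (λ H → SpanningCactus H G ×
    (∀ H′ → SpanningCactus H′ G → numEdges H′ ≤ numEdges H) ×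
    AllCyclesTriangles H)
mainTheorem8 G conn chordal with optimal-exists G
... | H , opt@(H⊆G , cH , _) =
  H , (H⊆G , cactusCycles⇒cactus (optimal-connected G opt conn) cH) ,
  (λ K spanning → optimal-maximum G {H} opt K (proj₁ spanning) (cactus⇒cactusCycles (proj₂ spanning))) ,
  optimal-triangles G opt chordal
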